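{- Let $n,t$ be non-negative integers with $n>t$. Then (a) $C_{2n+1}^{2t+1}\cong K_{\frac{2n+1}{n-t}}$; (b) $\theta(C_{2n+1})=\frac{2n+1}{3}$.
   Context: $C_{2n+1}$ is the cycle of length $2n+1$. For a positive integer $k$, $G^{k}$ has vertex set $V(G)$, with $u,v$ adjacent iff there is a walk of length $k$ between them in $G$. For integers $p\ge 2q\ge 2$, the circular complete graph $K_{p/q}$ has vertices $v_0,\ldots,v_{p-1}$ with $v_iv_j$ an edge iff $q\le|i-j|\le p-q$. $S_t(G)$ replaces each edge by a path with exactly $t-1$ inner vertices, and $G^{\frac{2r+1}{2s+1}}:=(S_{2s+1}(G))^{2r+1}$ for non-negative integers $r,s$. $og(G)$ is the odd girth. For a non-bipartite graph $G$, $\theta(G):=\sup\{\frac{2r+1}{2s+1}: r,s\ge 0 \text{ integers},\ \chi(G^{\frac{2r+1}{2s+1}})\le\chi(G),\ \frac{2r+1}{2s+1}<og(G)\}$. -}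

module Defs where

open import Data.Nat using (ℕ; zero; suc; _+_; _*_; _∸_; _≤_; _<_; _≡ᵇ_; ∣_-_∣)
open import Data.Nat.Properties using (_<?_)
open import Data.Bool using (Bool; T; _∨_; _∧_)
open import Data.Fin using (Fin; toℕ; fromℕ<)
open import Data.Product using (Σ; _×_; _,_; proj₁; proj₂)
open import Data.Sum using (_⊎_; inj₁; inj₂)
open import Relation.Nullary using (yes; no)
open import Relation.Binary.PropositionalEquality using (_≡_; _≢_)
open import Function.Bundles using (_↔_; Inverse; _⇔_)
open import Function.Definitions using (Injective)

record Graph : Set₁ where
  field
    V : Set
    E : V → V → Set
open Graph public

record FinGraph : Set where
  field
    size : ℕ
    adj  : Fin size → Fin size → Bool
open FinGraph public

toGraph : FinGraph → Graph
toGraph G = record { V = Fin (size G) ; E = λ u v → T (adj G u v) }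

-- Cycle C_m on vertices 0..m-1, i ~ i+1 (indices mod m).
Cycle : ℕ → FinGraph
Cycle m = record { size = m ; adj = a }
  where
  a : Fin m → Fin m → Bool
  a i j = (suc (toℕ i) ≡ᵇ toℕ j) ∨ ((suc (toℕ i) ≡ᵇ m) ∧ (toℕ j ≡ᵇ 0))
        ∨ (suc (toℕ j) ≡ᵇ toℕ i) ∨ ((suc (toℕ j) ≡ᵇ m) ∧ (toℕ i ≡ᵇ 0))

data Walk (G : Graph) : ℕ → V G → V G → Set where
  nil  : ∀ {x} → Walk G 0 x x
  cons : ∀ {k x y z} → E G x y → Walk G k y z → Walk G (suc k) x z

Power : Graph → ℕ → Graph
Power G k = record { V = V G ; E = Walk G k }

CircK : ℕ → ℕ → Graph
CircK p q = record { V = Fin p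
                   ; E = λ i j → (q ≤ ∣ toℕ i - toℕ j ∣) × (∣ toℕ i - toℕ j ∣ ≤ p ∸ q) }

-- Subdivision S_t(G): each edge {u,v} (stored once, with u < v) is replaced
-- by a path u = p_0, p_1, ..., p_t = v with t-1 new inner vertices.
EdgeOf : FinGraph → Set
EdgeOf G = Σ (Fin (size G)) λ u → Σ (Fin (size G)) λ v →
             (toℕ u < toℕ v) × T (adj G u v)

SubV : FinGraph → ℕ → Set
SubV G t = Fin (size G) ⊎ (EdgeOf G × Fin (t ∸ 1))

-- pos G t e k = the k-th vertex p_k on the path replacing edge e.
pos : (G : FinGraph) (t : ℕ) → EdgeOf G → ℕ → SubV G t
pos G t e zero = inj₁ (proj₁ e)
pos G t e (suc k) with k <? (t ∸ 1)
... | yes p = inj₂ (e , fromℕ< p)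
... | no  _ = inj₁ (proj₁ (proj₂ e))

Subdiv : ℕ → FinGraph → Graph
Subdiv t G = record
  { V = SubV G t
  ; E = λ x y → Σ (EdgeOf G) λ e → Σ ℕ λ k → (k < t) ×
          ((pos G t e k ≡ x × pos G t e (suc k) ≡ y)
           ⊎ (pos G t e (suc k) ≡ x × pos G t e k ≡ y)) }

-- G^{(2r+1)/(2s+1)} := (S_{2s+1}(G))^{2r+1}
FracPower : FinGraph → ℕ → ℕ → Graph
FracPower G r s = Power (Subdiv (2 * s + 1) G) (2 * r + 1)

_≅_ : Graph → Graph → Set
G ≅ H = Σ (V G ↔ V H) λ f →
          ∀ x y → E G x y ⇔ E H (Inverse.to f x) (Inverse.to f y)

Colorable : Graph → ℕ → Set
Colorable G k = Σ (V G → Fin k) λ c → ∀ x y → E G x y → c x ≢ c y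

IsChromaticNumber : Graph → ℕ → Set
IsChromaticNumber G k = Colorable G k × (∀ j → Colorable G j → k ≤ j)

HasCycle : Graph → ℕ → Set
HasCycle G k = (3 ≤ k) × Σ (Fin k → V G) λ c → Injective _≡_ _≡_ c ×
  (∀ i j → (suc (toℕ i) ≡ toℕ j ⊎ (suc (toℕ i) ≡ k × toℕ j ≡ 0)) → E G (c i) (c j))

Odd : ℕ → Set
Odd g = Σ ℕ λ m → g ≡ 2 * m + 1

IsOddGirth : Graph → ℕ → Set
IsOddGirth G g = Odd g × HasCycle G g × (∀ k → Odd k → HasCycle G k → g ≤ k)

-- The pair (r,s) is admissible in the definition of θ(G):
-- χ(G^{(2r+1)/(2s+1)}) ≤ χ(G) and (2r+1)/(2s+1) < og(G).
ThetaAdmissible : FinGraph → ℕ → ℕ → Set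
ThetaAdmissible G r s =
  (Σ ℕ λ k → IsChromaticNumber (toGraph G) k × Colorable (FracPower G r s) k) ×
  (Σ ℕ λ g → IsOddGirth (toGraph G) g × (2 * r + 1 < g * (2 * s + 1)))

-- θ(G) = a/b (b > 0): a/b is the supremum (least upper bound) of the set of
-- rationals (2r+1)/(2s+1) over admissible (r,s); comparisons by cross-multiplication.
IsTheta : FinGraph → ℕ → ℕ → Set
IsTheta G a b =
  (∀ r s → ThetaAdmissible G r s → (2 * r + 1) * b ≤ a * (2 * s + 1)) ×
  (∀ c d → 0 < d →
     (∀ r s → ThetaAdmissible G r s → (2 * r + 1) * d ≤ c * (2 * s + 1)) →
     a * d ≤ c * b)

-- Multiplying vertex labels by n maps C_{2n+1}^{2t+1} onto K_{(2n+1)/(n-t)}: a walk of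
-- length 2t+1 with j backward steps moves by 2t+1-2j, and as 2n ≡ -1 this becomes a move
-- by n-t+j, which ranges over exactly the circular distances n-t, …, n+t+1 of K.
-- For θ, S_{2s+1}(C_{2n+1}) and C_N with N = (2s+1)(2n+1) = 2M+1 map homomorphically into
-- each other, so C_{2n+1}^{(2r+1)/(2s+1)} is 3-colourable iff C_N^{2r+1} ≅ K_{N/(M-r)} is,
-- i.e. iff 3(2r+1) ≤ N, because K_{p/q} is 3-colourable exactly when p ≤ 3q. Every admissible
-- ratio is therefore at most (2n+1)/3, and r = n, s = 1 attains it.

module Submission where

open import Defs
open import Data.Bool using (T; _∨_; _∧_)
open import Data.Bool.Properties using (T-∨; T-∧; ∨-assoc)
open import Data.Nat as ℕ using (ℕ; zero; suc; _+_; _*_; _∸_; _<_; _≤_; _⊔_; z≤n; s≤s; NonZero; _≡ᵇ_; ∣_-_∣)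
import Data.Nat.Properties as ℕ
open import Data.Nat.DivMod
  using (_/_; _%_; m≡m%n+[m/n]*n; m%n<n; m<n*o⇒m/o<n; +-distrib-/-∣ʳ; m<n⇒m/n≡0; m*n/n≡m; [m+kn]%n≡m%n; m<n⇒m%n≡m)
open import Data.Nat.Divisibility using (n∣m*n)
import Data.Nat.Tactic.RingSolver as ℕ-Solver
open import Data.Integer as ℤ using (ℤ; +_; -[1+_]) renaming (_+_ to _+ᶻ_; _-_ to _-ᶻ_; _*_ to _*ᶻ_; -_ to -ᶻ_)
import Data.Integer.Properties as ℤ
open import Data.Integer.DivMod using (_/ℕ_; n%ℕd<d; a≡a%ℕn+[a/ℕn]*n)
open import Data.Integer.Divisibility.Signed using (_∣_; divides; ∣m⇒∣-m; ∣m∣n⇒∣m+n)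
open import Data.Integer.Tactic.RingSolver using (solve-∀)
open import Data.Fin using (Fin; toℕ; fromℕ; fromℕ<; inject≤; inject₁) renaming (zero to 0F; suc to sucF)
import Data.Fin.Properties as Fin
open import Data.Product using (_×_; _,_; ∃-syntax; proj₁; proj₂)
open import Data.Product.Function.NonDependent.Propositional using (_×-⇔_)
open import Data.Sum using (_⊎_; inj₁; inj₂; [_,_]; swap)
open import Data.Sum.Function.Propositional using (_⊎-⇔_)
open import Function using (_∘_; _$_)
open import Function.Bundles using (_⇔_; _↔_; mk⇔; mk↔ₛ′; Equivalence; Inverse)
open import Function.Construct.Composition using (_⇔-∘_)
open import Function.Construct.Symmetry using (⇔-sym)
open import Function.Definitions using (Injective)
open import Relation.Nullary using (¬_; Dec; yes; no; contradiction)
open import Relation.Binary.Bundles using (Setoid)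
open import Relation.Binary.Structures using (IsEquivalence)
open import Relation.Binary.PropositionalEquality hiding ([_])
import Relation.Binary.Reasoning.Setoid as SetoidReasoning

-- Congruences modulo m

infix 4 _≡_mod_
record _≡_mod_ (a b : ℤ) (m : ℕ) : Set where
  constructor mk≡-mod
  field
    m∣a-b : + m ∣ a -ᶻ b

module _ {m : ℕ} where

  ≡-mod-by : ∀ {a b} k → a ≡ b +ᶻ k *ᶻ + m → a ≡ b mod m
  ≡-mod-by {a} {b} k refl = mk≡-mod (divides k (lemma b k (+ m)))
    where
    lemma : ∀ b k m → b +ᶻ k *ᶻ m -ᶻ b ≡ k *ᶻ m
    lemma = solve-∀

  ≡⇒≡-mod : ∀ {a b} → a ≡ b → a ≡ b mod m
  ≡⇒≡-mod {a} refl = ≡-mod-by (+ 0) (sym (ℤ.+-identityʳ a))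

  ≡-mod-sym : ∀ {a b} → a ≡ b mod m → b ≡ a mod m
  ≡-mod-sym {a} {b} (mk≡-mod m∣a-b) = mk≡-mod $ subst (+ m ∣_) (lemma a b) (∣m⇒∣-m m∣a-b)
    where
    lemma : ∀ a b → -ᶻ (a -ᶻ b) ≡ b -ᶻ a
    lemma = solve-∀

  ≡-mod-trans : ∀ {a b c} → a ≡ b mod m → b ≡ c mod m → a ≡ c mod m
  ≡-mod-trans {a} {b} {c} (mk≡-mod m∣a-b) (mk≡-mod m∣b-c) =
    mk≡-mod $ subst (+ m ∣_) (lemma a b c) (∣m∣n⇒∣m+n m∣a-b m∣b-c)
    where
    lemma : ∀ a b c → a -ᶻ b +ᶻ (b -ᶻ c) ≡ a -ᶻ c
    lemma = solve-∀

  ≡-mod-isEquivalence : IsEquivalence (λ a b → a ≡ b mod m)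
  ≡-mod-isEquivalence = record
    { refl = ≡⇒≡-mod refl ; sym = ≡-mod-sym ; trans = ≡-mod-trans }

  ≡-mod-setoid : Setoid _ _
  ≡-mod-setoid = record { isEquivalence = ≡-mod-isEquivalence }

  +-cong-≡-mod : ∀ {a b c d} → a ≡ b mod m → c ≡ d mod m → a +ᶻ c ≡ b +ᶻ d mod m
  +-cong-≡-mod {a} {b} {c} {d} (mk≡-mod m∣a-b) (mk≡-mod m∣c-d) =
    mk≡-mod $ subst (+ m ∣_) (lemma a b c d) (∣m∣n⇒∣m+n m∣a-b m∣c-d)
    where
    lemma : ∀ a b c d → a -ᶻ b +ᶻ (c -ᶻ d) ≡ a +ᶻ c -ᶻ (b +ᶻ d)
    lemma = solve-∀

  +-congˡ-≡-mod : ∀ c {a b} → a ≡ b mod m → c +ᶻ a ≡ c +ᶻ b mod m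
  +-congˡ-≡-mod c a≡b = +-cong-≡-mod (≡⇒≡-mod {a = c} refl) a≡b

  +-congʳ-≡-mod : ∀ c {a b} → a ≡ b mod m → a +ᶻ c ≡ b +ᶻ c mod m
  +-congʳ-≡-mod c a≡b = +-cong-≡-mod a≡b (≡⇒≡-mod {a = c} refl)

  *-congˡ-≡-mod : ∀ c {a b} → a ≡ b mod m → c *ᶻ a ≡ c *ᶻ b mod m
  *-congˡ-≡-mod c {a} {b} (mk≡-mod (divides k a-b≡km)) = mk≡-mod $ divides (c *ᶻ k) (begin
    c *ᶻ a -ᶻ c *ᶻ b  ≡⟨ lemma c a b ⟩
    c *ᶻ (a -ᶻ b)     ≡⟨ cong (c *ᶻ_) a-b≡km ⟩
    c *ᶻ (k *ᶻ + m)   ≡⟨ ℤ.*-assoc c k (+ m) ⟨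
    c *ᶻ k *ᶻ + m     ∎)
    where
    open ≡-Reasoning
    lemma : ∀ c a b → c *ᶻ a -ᶻ c *ᶻ b ≡ c *ᶻ (a -ᶻ b)
    lemma = solve-∀

  +-multiple-≡-mod : ∀ a k → a +ᶻ k *ᶻ + m ≡ a mod m
  +-multiple-≡-mod a k = ≡-mod-by k refl

  +-cancelˡ-≡-mod : ∀ c {a b} → c +ᶻ a ≡ c +ᶻ b mod m → a ≡ b mod m
  +-cancelˡ-≡-mod c {a} {b} c+a≡c+b =
    ≡-mod-trans (≡⇒≡-mod (lemma c a)) (≡-mod-trans (+-congˡ-≡-mod (-ᶻ c) c+a≡c+b) (≡⇒≡-mod (sym (lemma c b))))
    where
    lemma : ∀ c a → a ≡ -ᶻ c +ᶻ (c +ᶻ a)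
    lemma = solve-∀

  m≡0-mod : + m ≡ + 0 mod m
  m≡0-mod = ≡-mod-by (+ 1) (sym (trans (ℤ.+-identityˡ _) (ℤ.*-identityˡ (+ m))))

  private
    multiple-too-large : ∀ {a b} k → + a ≡ + b +ᶻ + suc k *ᶻ + m → ¬ a < m
    multiple-too-large {a} {b} k a≡b+km a<m = ℕ.<⇒≱ a<m (begin
      m              ≤⟨ ℕ.m≤n*m m (suc k) ⟩
      suc k * m      ≤⟨ ℕ.m≤n+m (suc k * m) b ⟩
      b + suc k * m  ≡⟨ ℤ.+-injective (trans a≡b+km (cong (+ b +ᶻ_) (sym (ℤ.pos-* (suc k) m)))) ⟨
      a              ∎)
      where open ℕ.≤-Reasoning

  ≡-mod⇒≡ : ∀ {a b} → a < m → b < m → + a ≡ + b mod m → a ≡ b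
  ≡-mod⇒≡ {a} {b} a<m b<m (mk≡-mod (divides k a-b≡km)) with k
  ... | + zero   = ℤ.+-injective (ℤ.i-j≡0⇒i≡j (+ a) (+ b) a-b≡km)
  ... | + suc k  = contradiction a<m (multiple-too-large k (trans (split (+ a) (+ b)) (cong (+ b +ᶻ_) a-b≡km)))
    where
    split : ∀ a b → a ≡ b +ᶻ (a -ᶻ b)
    split = solve-∀
  ... | -[1+ k ] = contradiction b<m (multiple-too-large k b≡a+km)
    where
    split : ∀ a b → b ≡ a +ᶻ -ᶻ (a -ᶻ b)
    split = solve-∀
    b≡a+km : + b ≡ + a +ᶻ + suc k *ᶻ + m
    b≡a+km = begin
      + b                              ≡⟨ split (+ a) (+ b) ⟩
      + a +ᶻ -ᶻ (+ a -ᶻ + b)           ≡⟨ cong (λ c → + a +ᶻ -ᶻ c) a-b≡km ⟩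
      + a +ᶻ -ᶻ (-[1+ k ] *ᶻ + m)      ≡⟨ cong (+ a +ᶻ_) (ℤ.neg-distribˡ-* -[1+ k ] (+ m)) ⟩
      + a +ᶻ + suc k *ᶻ + m            ∎
      where open ≡-Reasoning

≡-mod-compose : ∀ {m y z} x d e {f} → y ≡ x +ᶻ d mod m → z ≡ y +ᶻ e mod m → d +ᶻ e ≡ f →
                z ≡ x +ᶻ f mod m
≡-mod-compose x d e y≡x+d z≡y+e refl =
  ≡-mod-trans z≡y+e (≡-mod-trans (+-congʳ-≡-mod e y≡x+d) (≡⇒≡-mod (ℤ.+-assoc x d e)))

≡-mod-back : ∀ {m x} y → x ≡ y +ᶻ + 1 mod m → y ≡ x +ᶻ -ᶻ + 1 mod m
≡-mod-back y x≡y+1 =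
  ≡-mod-trans (≡⇒≡-mod (lemma y)) (+-congʳ-≡-mod (-ᶻ + 1) (≡-mod-sym x≡y+1))
  where
  lemma : ∀ y → y ≡ y +ᶻ + 1 +ᶻ -ᶻ + 1
  lemma = solve-∀

module ≡-mod-Reasoning (m : ℕ) = SetoidReasoning (≡-mod-setoid {m})

module _ {m : ℕ} .{{_ : NonZero m}} where

  residue : ℤ → Fin m
  residue a = fromℕ< (n%ℕd<d a m)

  residue-≡-mod : ∀ a → + toℕ (residue a) ≡ a mod m
  residue-≡-mod a = ≡-mod-sym (≡-mod-by (a /ℕ m)
    (trans (a≡a%ℕn+[a/ℕn]*n a m) (cong (λ r → + r +ᶻ a /ℕ m *ᶻ + m) (sym (Fin.toℕ-fromℕ< _)))))

-- Walks in cycles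

Cyc : ℕ → Graph
Cyc m = toGraph (Cycle m)

Next : ℕ → ℕ → ℕ → Set
Next m i j = suc i ≡ j ⊎ (suc i ≡ m × j ≡ 0)

Step : ∀ {m} → Fin m → Fin m → Set
Step {m} i j = + toℕ j ≡ + toℕ i +ᶻ + 1 mod m

cycle-edge⇔next : ∀ {m} (i j : Fin m) →
                  E (Cyc m) i j ⇔ (Next m (toℕ i) (toℕ j) ⊎ Next m (toℕ j) (toℕ i))
cycle-edge⇔next {m} i j =
  subst (λ b → T b ⇔ (Next m (toℕ i) (toℕ j) ⊎ Next m (toℕ j) (toℕ i))) (∨-assoc (suc (toℕ i) ≡ᵇ toℕ j) _ _)
        ((T-next (toℕ i) (toℕ j) ⊎-⇔ T-next (toℕ j) (toℕ i)) ⇔-∘ T-∨)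
  where
  T-≡ᵇ : ∀ a b → T (a ≡ᵇ b) ⇔ a ≡ b
  T-≡ᵇ a b = mk⇔ (ℕ.≡ᵇ⇒≡ a b) (ℕ.≡⇒≡ᵇ a b)
  T-next : ∀ a b → T ((suc a ≡ᵇ b) ∨ ((suc a ≡ᵇ m) ∧ (b ≡ᵇ 0))) ⇔ Next m a b
  T-next a b = (T-≡ᵇ _ _ ⊎-⇔ ((T-≡ᵇ _ _ ×-⇔ T-≡ᵇ _ _) ⇔-∘ T-∧)) ⇔-∘ T-∨

next⇔step : ∀ {m} (i j : Fin m) → Next m (toℕ i) (toℕ j) ⇔ Step i j
next⇔step {m} i j = mk⇔ to from
  where
  i+1≡1+i : + toℕ i +ᶻ + 1 ≡ + suc (toℕ i)
  i+1≡1+i = cong +_ (ℕ.+-comm (toℕ i) 1)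
  to : Next m (toℕ i) (toℕ j) → Step i j
  to (inj₁ 1+i≡j) = ≡⇒≡-mod (trans (cong +_ (sym 1+i≡j)) (sym i+1≡1+i))
  to (inj₂ (1+i≡m , j≡0)) = ≡-mod-trans (≡⇒≡-mod (cong +_ j≡0))
    (≡-mod-trans (≡-mod-sym m≡0-mod) (≡⇒≡-mod (sym (trans i+1≡1+i (cong +_ 1+i≡m)))))
  from : Step i j → Next m (toℕ i) (toℕ j)
  from j≡i+1 with suc (toℕ i) ℕ.<? m
  ... | yes 1+i<m = inj₁ (sym (≡-mod⇒≡ (Fin.toℕ<n j) 1+i<m (≡-mod-trans j≡i+1 (≡⇒≡-mod i+1≡1+i))))
  ... | no 1+i≮m = inj₂ (1+i≡m , ≡-mod⇒≡ (Fin.toℕ<n j) 0<m j≡0)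
    where
    1+i≡m : suc (toℕ i) ≡ m
    1+i≡m = ℕ.≤-antisym (Fin.toℕ<n i) (ℕ.≮⇒≥ 1+i≮m)
    0<m : 0 < m
    0<m = ℕ.<-≤-trans (s≤s z≤n) (ℕ.≤-reflexive 1+i≡m)
    j≡0 : + toℕ j ≡ + 0 mod m
    j≡0 = ≡-mod-trans j≡i+1 (≡-mod-trans (≡⇒≡-mod (trans i+1≡1+i (cong +_ 1+i≡m))) m≡0-mod)

cycle-edge⇔step : ∀ {m} (i j : Fin m) → E (Cyc m) i j ⇔ (Step i j ⊎ Step j i)
cycle-edge⇔step i j = (next⇔step i j ⊎-⇔ next⇔step j i) ⇔-∘ cycle-edge⇔next i j

cycle-edge-sym : ∀ {m} (i j : Fin m) → E (Cyc m) i j → E (Cyc m) j i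
cycle-edge-sym i j i~j = Equivalence.from (cycle-edge⇔next j i) (swap (Equivalence.to (cycle-edge⇔next i j) i~j))

-- z is reached from x by ℓ steps of ±1, j of them backwards.
Reach : ∀ {m} → ℕ → Fin m → Fin m → Set
Reach {m} ℓ x z = ∃[ j ] j ≤ ℓ × + toℕ z ≡ + toℕ x +ᶻ (+ ℓ -ᶻ + 2 *ᶻ + j) mod m

forward-step : ∀ ℓ j → + 1 +ᶻ (+ ℓ -ᶻ + 2 *ᶻ + j) ≡ + suc ℓ -ᶻ + 2 *ᶻ + j
forward-step ℓ j = trans (lemma (+ ℓ) (+ j)) (cong (λ l → l -ᶻ + 2 *ᶻ + j) (sym (ℤ.pos-+ 1 ℓ)))
  where
  lemma : ∀ l j → + 1 +ᶻ (l -ᶻ + 2 *ᶻ j) ≡ + 1 +ᶻ l -ᶻ + 2 *ᶻ j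
  lemma = solve-∀

backward-step : ∀ ℓ j → -ᶻ + 1 +ᶻ (+ ℓ -ᶻ + 2 *ᶻ + j) ≡ + suc ℓ -ᶻ + 2 *ᶻ + suc j
backward-step ℓ j = trans (lemma (+ ℓ) (+ j))
  (cong₂ (λ l k → l -ᶻ + 2 *ᶻ k) (sym (ℤ.pos-+ 1 ℓ)) (sym (ℤ.pos-+ 1 j)))
  where
  lemma : ∀ l j → -ᶻ + 1 +ᶻ (l -ᶻ + 2 *ᶻ j) ≡ + 1 +ᶻ l -ᶻ + 2 *ᶻ (+ 1 +ᶻ j)
  lemma = solve-∀

no-displacement : ∀ x → x ≡ x +ᶻ (+ 0 -ᶻ + 2 *ᶻ + 0)
no-displacement = solve-∀

walk⇒reach : ∀ {m ℓ x z} → Walk (Cyc m) ℓ x z → Reach ℓ x z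
walk⇒reach {x = x} nil = 0 , z≤n , ≡⇒≡-mod (no-displacement (+ toℕ x))
walk⇒reach (cons {ℓ} {x} {y} x~y w) with walk⇒reach w | Equivalence.to (cycle-edge⇔step x y) x~y
... | j , j≤ℓ , z≡y+d | inj₁ y≡x+1 =
  j , ℕ.m≤n⇒m≤1+n j≤ℓ , ≡-mod-compose (+ toℕ x) (+ 1) (+ ℓ -ᶻ + 2 *ᶻ + j) y≡x+1 z≡y+d (forward-step ℓ j)
... | j , j≤ℓ , z≡y+d | inj₂ x≡y+1 =
  suc j , s≤s j≤ℓ ,
  ≡-mod-compose (+ toℕ x) (-ᶻ + 1) (+ ℓ -ᶻ + 2 *ᶻ + j) (≡-mod-back (+ toℕ y) x≡y+1) z≡y+d (backward-step ℓ j)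

module _ {m : ℕ} .{{_ : NonZero m}} where

  infixl 6 _⊕_
  _⊕_ : Fin m → ℤ → Fin m
  i ⊕ d = residue (+ toℕ i +ᶻ d)

  ⊕-≡-mod : ∀ i d → + toℕ (i ⊕ d) ≡ + toℕ i +ᶻ d mod m
  ⊕-≡-mod i d = residue-≡-mod (+ toℕ i +ᶻ d)

  edge-⊕1 : (i : Fin m) → E (Cyc m) i (i ⊕ + 1)
  edge-⊕1 i = Equivalence.from (cycle-edge⇔step i (i ⊕ + 1)) (inj₁ (⊕-≡-mod i (+ 1)))

  edge-⊖1 : (i : Fin m) → E (Cyc m) i (i ⊕ -ᶻ + 1)
  edge-⊖1 i = Equivalence.from (cycle-edge⇔step i (i ⊕ -ᶻ + 1))
    (inj₂ (≡-mod-trans (≡⇒≡-mod (lemma (+ toℕ i))) (+-congʳ-≡-mod (+ 1) (≡-mod-sym (⊕-≡-mod i (-ᶻ + 1))))))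
    where
    lemma : ∀ i → i ≡ i +ᶻ -ᶻ + 1 +ᶻ + 1
    lemma = solve-∀

  walk-with-backsteps : ∀ ℓ j → j ≤ ℓ → (x : Fin m) →
    ∃[ z ] Walk (Cyc m) ℓ x z × + toℕ z ≡ + toℕ x +ᶻ (+ ℓ -ᶻ + 2 *ᶻ + j) mod m
  walk-with-backsteps zero zero z≤n x = x , nil , ≡⇒≡-mod (no-displacement (+ toℕ x))
  walk-with-backsteps (suc ℓ) zero z≤n x with walk-with-backsteps ℓ 0 z≤n (x ⊕ + 1)
  ... | z , w , z≡y+d = z , cons (edge-⊕1 x) w ,
    ≡-mod-compose (+ toℕ x) (+ 1) (+ ℓ -ᶻ + 2 *ᶻ + 0) (⊕-≡-mod x (+ 1)) z≡y+d (forward-step ℓ 0)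
  walk-with-backsteps (suc ℓ) (suc j) (s≤s j≤ℓ) x with walk-with-backsteps ℓ j j≤ℓ (x ⊕ -ᶻ + 1)
  ... | z , w , z≡y+d = z , cons (edge-⊖1 x) w ,
    ≡-mod-compose (+ toℕ x) (-ᶻ + 1) (+ ℓ -ᶻ + 2 *ᶻ + j) (⊕-≡-mod x (-ᶻ + 1)) z≡y+d (backward-step ℓ j)

  reach⇒walk : ∀ {ℓ} {x z : Fin m} → Reach ℓ x z → Walk (Cyc m) ℓ x z
  reach⇒walk {ℓ} {x} {z} (j , j≤ℓ , z≡x+d) with walk-with-backsteps ℓ j j≤ℓ x
  ... | z′ , w , z′≡x+d = subst (Walk (Cyc m) ℓ x) z′≡z w
    where
    z′≡z : z′ ≡ z
    z′≡z = Fin.toℕ-injective (≡-mod⇒≡ (Fin.toℕ<n z′) (Fin.toℕ<n z) (≡-mod-trans z′≡x+d (≡-mod-sym z≡x+d)))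

  walk⇔reach : ∀ {ℓ} {x z : Fin m} → Walk (Cyc m) ℓ x z ⇔ Reach ℓ x z
  walk⇔reach = mk⇔ walk⇒reach reach⇒walk

-- Odd powers of odd cycles are circular cliques

gap-flip : ∀ {m q e} → q ≤ e → e ≤ m ∸ q → q ≤ m ∸ e × m ∸ e ≤ m ∸ q
gap-flip {m} {q} {e} q≤e e≤m∸q =
  ℕ.m+n≤o⇒m≤o∸n q (subst (_≤ m) (ℕ.+-comm e q) (ℕ.m≤o∸n⇒m+n≤o e q≤m e≤m∸q)) , ℕ.∸-monoʳ-≤ m q≤e
  where
  q≤m : q ≤ m
  q≤m = ℕ.≤-trans q≤e (ℕ.≤-trans e≤m∸q (ℕ.m∸n≤m m q))

gap<m : ∀ {m q e} → 0 < q → q ≤ e → e ≤ m ∸ q → e < m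
gap<m {m} {q} 0<q q≤e e≤m∸q =
  ℕ.≤-<-trans e≤m∸q (ℕ.∸-monoʳ-< 0<q (ℕ.≤-trans q≤e (ℕ.≤-trans e≤m∸q (ℕ.m∸n≤m m q))))

Offset : ∀ {m} → ℕ → Fin m → Fin m → Set
Offset {m} q a b = ∃[ e ] q ≤ e × e ≤ m ∸ q × + toℕ b ≡ + toℕ a +ᶻ + e mod m

circK-edge⇒offset : ∀ {m q} (a b : Fin m) → E (CircK m q) a b → Offset q a b
circK-edge⇒offset {m} {q} a b (q≤∣a-b∣ , ∣a-b∣≤m∸q) with toℕ a ℕ.≤? toℕ b
... | yes a≤b = toℕ b ∸ toℕ a , subst (q ≤_) d≡ q≤∣a-b∣ , subst (_≤ m ∸ q) d≡ ∣a-b∣≤m∸q ,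
                ≡⇒≡-mod (cong +_ (sym (ℕ.m+[n∸m]≡n a≤b)))
  where
  d≡ : ∣ toℕ a - toℕ b ∣ ≡ toℕ b ∸ toℕ a
  d≡ = ℕ.m≤n⇒∣m-n∣≡n∸m a≤b
... | no a≰b = m ∸ d , proj₁ flipped , proj₂ flipped ,
               ≡-mod-sym (≡-mod-by (+ 1) (trans (cong +_ a+[m∸d]≡b+m) (cong (+ toℕ b +ᶻ_) (sym (ℤ.*-identityˡ (+ m))))))
  where
  b≤a = ℕ.<⇒≤ (ℕ.≰⇒> a≰b)
  d = toℕ a ∸ toℕ b
  d≡ : ∣ toℕ a - toℕ b ∣ ≡ d
  d≡ = ℕ.m≤n⇒∣n-m∣≡n∸m b≤a
  d≤m : d ≤ m
  d≤m = ℕ.≤-trans (ℕ.m∸n≤m (toℕ a) (toℕ b)) (ℕ.<⇒≤ (Fin.toℕ<n a))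
  flipped = gap-flip {m} (subst (q ≤_) d≡ q≤∣a-b∣) (subst (_≤ m ∸ q) d≡ ∣a-b∣≤m∸q)
  a+[m∸d]≡b+m : toℕ a + (m ∸ d) ≡ toℕ b + m
  a+[m∸d]≡b+m = begin
    toℕ a + (m ∸ d)          ≡⟨ cong (_+ (m ∸ d)) (ℕ.m+[n∸m]≡n b≤a) ⟨
    toℕ b + d + (m ∸ d)      ≡⟨ ℕ.+-assoc (toℕ b) d (m ∸ d) ⟩
    toℕ b + (d + (m ∸ d))    ≡⟨ cong (λ x → toℕ b + x) (ℕ.m+[n∸m]≡n d≤m) ⟩
    toℕ b + m                ∎
    where open ≡-Reasoning

offset⇒circK-edge : ∀ {m q} → 0 < q → (a b : Fin m) → Offset q a b → E (CircK m q) a b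
offset⇒circK-edge {m} {q} 0<q a b (e , q≤e , e≤m∸q , b≡a+e) with toℕ a ℕ.≤? toℕ b
... | yes a≤b = subst (q ≤_) (sym ∣a-b∣≡e) q≤e , subst (_≤ m ∸ q) (sym ∣a-b∣≡e) e≤m∸q
  where
  ∣a-b∣≡e : ∣ toℕ a - toℕ b ∣ ≡ e
  ∣a-b∣≡e = trans (ℕ.m≤n⇒∣m-n∣≡n∸m a≤b)
    (≡-mod⇒≡ (ℕ.≤-<-trans (ℕ.m∸n≤m (toℕ b) (toℕ a)) (Fin.toℕ<n b)) (gap<m 0<q q≤e e≤m∸q)
      (+-cancelˡ-≡-mod (+ toℕ a) (≡-mod-trans (≡⇒≡-mod (cong +_ (ℕ.m+[n∸m]≡n a≤b))) b≡a+e)))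
... | no a≰b = subst (q ≤_) (sym ∣a-b∣≡m∸e) (proj₁ flipped) , subst (_≤ m ∸ q) (sym ∣a-b∣≡m∸e) (proj₂ flipped)
  where
  b<a = ℕ.≰⇒> a≰b
  b≤a = ℕ.<⇒≤ b<a
  d = toℕ a ∸ toℕ b
  d≤m : d ≤ m
  d≤m = ℕ.≤-trans (ℕ.m∸n≤m (toℕ a) (toℕ b)) (ℕ.<⇒≤ (Fin.toℕ<n a))
  flipped = gap-flip {m} q≤e e≤m∸q
  0≡d+e : + 0 ≡ + d +ᶻ + e mod m
  0≡d+e = +-cancelˡ-≡-mod (+ toℕ b) $ ≡-mod-trans (≡⇒≡-mod (ℤ.+-identityʳ (+ toℕ b))) $ ≡-mod-trans b≡a+e $
    ≡⇒≡-mod (trans (cong (λ x → + x +ᶻ + e) (sym (ℕ.m+[n∸m]≡n b≤a))) (ℤ.+-assoc (+ toℕ b) (+ d) (+ e)))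
  m∸d≡e : m ∸ d ≡ e
  m∸d≡e = ≡-mod⇒≡ (ℕ.∸-monoʳ-< (ℕ.m<n⇒0<n∸m b<a) d≤m) (gap<m 0<q q≤e e≤m∸q) $ +-cancelˡ-≡-mod (+ d) $
    ≡-mod-trans (≡⇒≡-mod (cong +_ (ℕ.m+[n∸m]≡n d≤m))) (≡-mod-trans m≡0-mod 0≡d+e)
  ∣a-b∣≡m∸e : ∣ toℕ a - toℕ b ∣ ≡ m ∸ e
  ∣a-b∣≡m∸e = trans (ℕ.m≤n⇒∣n-m∣≡n∸m b≤a) (trans (sym (ℕ.m∸[m∸n]≡n d≤m)) (cong (m ∸_) m∸d≡e))

circK-edge⇔offset : ∀ {m q} → 0 < q → (a b : Fin m) → E (CircK m q) a b ⇔ Offset q a b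
circK-edge⇔offset 0<q a b = mk⇔ (circK-edge⇒offset a b) (offset⇒circK-edge 0<q a b)

module _ {m : ℕ} .{{_ : NonZero m}} where

  infixr 7 _·_
  _·_ : ℤ → Fin m → Fin m
  u · i = residue (u *ᶻ + toℕ i)

  ·-inverse : ∀ u v → u *ᶻ v ≡ + 1 mod m → ∀ i → u · v · i ≡ i
  ·-inverse u v uv≡1 i = Fin.toℕ-injective $ ≡-mod⇒≡ (Fin.toℕ<n (u · v · i)) (Fin.toℕ<n i) $ begin
    + toℕ (u · v · i)          ≈⟨ residue-≡-mod (u *ᶻ + toℕ (v · i)) ⟩
    u *ᶻ + toℕ (v · i)         ≈⟨ *-congˡ-≡-mod u (residue-≡-mod (v *ᶻ + toℕ i)) ⟩
    u *ᶻ (v *ᶻ + toℕ i)        ≡⟨ lemma u v (+ toℕ i) ⟩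
    + toℕ i *ᶻ (u *ᶻ v)        ≈⟨ *-congˡ-≡-mod (+ toℕ i) uv≡1 ⟩
    + toℕ i *ᶻ + 1             ≡⟨ ℤ.*-identityʳ (+ toℕ i) ⟩
    + toℕ i                    ∎
    where
    open ≡-mod-Reasoning m
    lemma : ∀ u v i → u *ᶻ (v *ᶻ i) ≡ i *ᶻ (u *ᶻ v)
    lemma = solve-∀

pos-double+1 : ∀ n → + (2 * n + 1) ≡ + 2 *ᶻ + n +ᶻ + 1
pos-double+1 n = trans (ℤ.pos-+ (2 * n) 1) (cong (_+ᶻ + 1) (ℤ.pos-* 2 n))

module Scaling (t q : ℕ) where

  n = t + q
  m = 2 * n + 1

  private
    pos-m : + m ≡ + 2 *ᶻ + n +ᶻ + 1
    pos-m = pos-double+1 n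
    pos-ℓ : + (2 * t + 1) ≡ + 2 *ᶻ + t +ᶻ + 1
    pos-ℓ = pos-double+1 t

  scale-walk : ∀ x y j → y ≡ x +ᶻ (+ (2 * t + 1) -ᶻ + 2 *ᶻ + j) mod m →
               + n *ᶻ y ≡ + n *ᶻ x +ᶻ + (q + j) mod m
  scale-walk x y j y≡x+d = begin
    + n *ᶻ y                                                  ≈⟨ *-congˡ-≡-mod (+ n) y≡x+d ⟩
    + n *ᶻ (x +ᶻ (+ (2 * t + 1) -ᶻ + 2 *ᶻ + j))               ≡⟨ cong (λ l → + n *ᶻ (x +ᶻ (l -ᶻ + 2 *ᶻ + j))) pos-ℓ ⟩
    + n *ᶻ (x +ᶻ (+ 2 *ᶻ + t +ᶻ + 1 -ᶻ + 2 *ᶻ + j))           ≡⟨ lemma (+ t) (+ q) x (+ j) ⟩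
    + n *ᶻ x +ᶻ + (q + j) +ᶻ (+ t -ᶻ + j) *ᶻ (+ 2 *ᶻ + n +ᶻ + 1) ≡⟨ cong (λ k → + n *ᶻ x +ᶻ + (q + j) +ᶻ (+ t -ᶻ + j) *ᶻ k) pos-m ⟨
    + n *ᶻ x +ᶻ + (q + j) +ᶻ (+ t -ᶻ + j) *ᶻ + m              ≈⟨ +-multiple-≡-mod _ (+ t -ᶻ + j) ⟩
    + n *ᶻ x +ᶻ + (q + j)                                     ∎
    where
    open ≡-mod-Reasoning m
    lemma : ∀ t q x j → (t +ᶻ q) *ᶻ (x +ᶻ (+ 2 *ᶻ t +ᶻ + 1 -ᶻ + 2 *ᶻ j)) ≡
                        (t +ᶻ q) *ᶻ x +ᶻ (q +ᶻ j) +ᶻ (t -ᶻ j) *ᶻ (+ 2 *ᶻ (t +ᶻ q) +ᶻ + 1)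
    lemma = solve-∀

  unscale-walk : ∀ x y j → + n *ᶻ y ≡ + n *ᶻ x +ᶻ + (q + j) mod m →
                 y ≡ x +ᶻ (+ (2 * t + 1) -ᶻ + 2 *ᶻ + j) mod m
  unscale-walk x y j ny≡nx+e = begin
    y                                                         ≡⟨ lemma₁ (+ n) y ⟩
    -ᶻ + 2 *ᶻ (+ n *ᶻ y) +ᶻ y *ᶻ (+ 2 *ᶻ + n +ᶻ + 1)           ≡⟨ cong (λ k → -ᶻ + 2 *ᶻ (+ n *ᶻ y) +ᶻ y *ᶻ k) pos-m ⟨
    -ᶻ + 2 *ᶻ (+ n *ᶻ y) +ᶻ y *ᶻ + m                          ≈⟨ +-multiple-≡-mod _ y ⟩
    -ᶻ + 2 *ᶻ (+ n *ᶻ y)                                      ≈⟨ *-congˡ-≡-mod (-ᶻ + 2) ny≡nx+e ⟩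
    -ᶻ + 2 *ᶻ (+ n *ᶻ x +ᶻ (+ q +ᶻ + j))                      ≡⟨ lemma₂ (+ t) (+ q) x (+ j) ⟩
    x +ᶻ (+ 2 *ᶻ + t +ᶻ + 1 -ᶻ + 2 *ᶻ + j) +ᶻ (-ᶻ (x +ᶻ + 1)) *ᶻ (+ 2 *ᶻ + n +ᶻ + 1)
                                                              ≡⟨ cong₂ (λ l k → x +ᶻ (l -ᶻ + 2 *ᶻ + j) +ᶻ (-ᶻ (x +ᶻ + 1)) *ᶻ k) pos-ℓ pos-m ⟨
    x +ᶻ (+ (2 * t + 1) -ᶻ + 2 *ᶻ + j) +ᶻ (-ᶻ (x +ᶻ + 1)) *ᶻ + m ≈⟨ +-multiple-≡-mod _ (-ᶻ (x +ᶻ + 1)) ⟩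
    x +ᶻ (+ (2 * t + 1) -ᶻ + 2 *ᶻ + j)                        ∎
    where
    open ≡-mod-Reasoning m
    lemma₁ : ∀ n y → y ≡ -ᶻ + 2 *ᶻ (n *ᶻ y) +ᶻ y *ᶻ (+ 2 *ᶻ n +ᶻ + 1)
    lemma₁ = solve-∀
    lemma₂ : ∀ t q x j → -ᶻ + 2 *ᶻ ((t +ᶻ q) *ᶻ x +ᶻ (q +ᶻ j)) ≡
               x +ᶻ (+ 2 *ᶻ t +ᶻ + 1 -ᶻ + 2 *ᶻ j) +ᶻ (-ᶻ (x +ᶻ + 1)) *ᶻ (+ 2 *ᶻ (t +ᶻ q) +ᶻ + 1)
    lemma₂ = solve-∀

  instance
    m-nonZero : NonZero m
    m-nonZero = ℕ.>-nonZero (ℕ.m≤n+m 1 (2 * n))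

  private
    m∸q≡q+ℓ : m ∸ q ≡ q + (2 * t + 1)
    m∸q≡q+ℓ = trans (cong (_∸ q) (lemma t q)) (ℕ.m+n∸m≡n q (q + (2 * t + 1)))
      where
      lemma : ∀ t q → 2 * (t + q) + 1 ≡ q + (q + (2 * t + 1))
      lemma = ℕ-Solver.solve-∀

  reach⇔offset : (x y : Fin m) → Reach (2 * t + 1) x y ⇔ Offset q (+ n · x) (+ n · y)
  reach⇔offset x y = mk⇔ to from
    where
    X = + toℕ x
    Y = + toℕ y
    to : Reach (2 * t + 1) x y → Offset q (+ n · x) (+ n · y)
    to (j , j≤ℓ , y≡x+d) = q + j , ℕ.m≤m+n q j , subst (q + j ≤_) (sym m∸q≡q+ℓ) (ℕ.+-monoʳ-≤ q j≤ℓ) , (begin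
      + toℕ (+ n · y)          ≈⟨ residue-≡-mod (+ n *ᶻ Y) ⟩
      + n *ᶻ Y                 ≈⟨ scale-walk X Y j y≡x+d ⟩
      + n *ᶻ X +ᶻ + (q + j)    ≈⟨ +-congʳ-≡-mod (+ (q + j)) (residue-≡-mod (+ n *ᶻ X)) ⟨
      + toℕ (+ n · x) +ᶻ + (q + j) ∎)
      where open ≡-mod-Reasoning m
    from : Offset q (+ n · x) (+ n · y) → Reach (2 * t + 1) x y
    from (e , q≤e , e≤m∸q , nx≡ny+e) = e ∸ q , j≤ℓ , unscale-walk X Y (e ∸ q) (begin
      + n *ᶻ Y                 ≈⟨ residue-≡-mod (+ n *ᶻ Y) ⟨
      + toℕ (+ n · y)          ≈⟨ nx≡ny+e ⟩
      + toℕ (+ n · x) +ᶻ + e   ≈⟨ +-congʳ-≡-mod (+ e) (residue-≡-mod (+ n *ᶻ X)) ⟩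
      + n *ᶻ X +ᶻ + e          ≡⟨ cong (λ k → + n *ᶻ X +ᶻ + k) (ℕ.m+[n∸m]≡n q≤e) ⟨
      + n *ᶻ X +ᶻ + (q + (e ∸ q)) ∎)
      where
      open ≡-mod-Reasoning m
      j≤ℓ : e ∸ q ≤ 2 * t + 1
      j≤ℓ = ℕ.+-cancelˡ-≤ q (e ∸ q) (2 * t + 1)
              (subst₂ _≤_ (sym (ℕ.m+[n∸m]≡n q≤e)) m∸q≡q+ℓ e≤m∸q)

  private
    -2n≡1 : -ᶻ + 2 *ᶻ + n ≡ + 1 mod m
    -2n≡1 = ≡-mod-by (-ᶻ + 1) (trans (lemma (+ n)) (cong (λ k → + 1 +ᶻ -ᶻ + 1 *ᶻ k) (sym pos-m)))
      where
      lemma : ∀ N → -ᶻ + 2 *ᶻ N ≡ + 1 +ᶻ -ᶻ + 1 *ᶻ (+ 2 *ᶻ N +ᶻ + 1)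
      lemma = solve-∀
    n-2≡1 : + n *ᶻ -ᶻ + 2 ≡ + 1 mod m
    n-2≡1 = ≡-mod-trans (≡⇒≡-mod (ℤ.*-comm (+ n) (-ᶻ + 2))) -2n≡1

  scaling : Fin m ↔ Fin m
  scaling = mk↔ₛ′ (+ n ·_) (-ᶻ + 2 ·_) (·-inverse (+ n) (-ᶻ + 2) n-2≡1) (·-inverse (-ᶻ + 2) (+ n) -2n≡1)

  oddCyclePower≅circularClique : 0 < q → Power (Cyc m) (2 * t + 1) ≅ CircK m q
  oddCyclePower≅circularClique 0<q = scaling , λ x y →
    ⇔-sym (circK-edge⇔offset 0<q (+ n · x) (+ n · y)) ⇔-∘ (reach⇔offset x y ⇔-∘ walk⇔reach)

-- Homomorphisms and colourings

Hom : (G H : Graph) → (V G → V H) → Set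
Hom G H f = ∀ x y → E G x y → E H (f x) (f y)

walk-map : ∀ {G H ℓ x y} (f : V G → V H) → Hom G H f → Walk G ℓ x y → Walk H ℓ (f x) (f y)
walk-map f f-hom nil = nil
walk-map f f-hom (cons e w) = cons (f-hom _ _ e) (walk-map f f-hom w)

power-hom : ∀ {G H} ℓ (f : V G → V H) → Hom G H f → Hom (Power G ℓ) (Power H ℓ) f
power-hom ℓ f f-hom x y = walk-map f f-hom

colorable-pullback : ∀ {G H k} (f : V G → V H) → Hom G H f → Colorable H k → Colorable G k
colorable-pullback f f-hom (c , c-proper) = c ∘ f , λ x y e → c-proper (f x) (f y) (f-hom x y e)

colorable-mono : ∀ {G j k} → j ≤ k → Colorable G j → Colorable G k
colorable-mono j≤k (c , c-proper) = (λ x → inject≤ (c x) j≤k) ,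
  λ x y e cx≡cy → c-proper x y e (Fin.inject≤-injective j≤k j≤k (c x) (c y) cx≡cy)

≅-colorable : ∀ {G H k} → G ≅ H → Colorable H k → Colorable G k
≅-colorable (f , f-iso) = colorable-pullback (Inverse.to f) (λ x y → Equivalence.to (f-iso x y))

≅-colorable⁻ : ∀ {G H k} → G ≅ H → Colorable G k → Colorable H k
≅-colorable⁻ {G} {H} (f , f-iso) = colorable-pullback (Inverse.from f) hom
  where
  hom : Hom H G (Inverse.from f)
  hom x y e = Equivalence.from (f-iso (Inverse.from f x) (Inverse.from f y))
                (subst₂ (E H) (sym (Inverse.strictlyInverseˡ f x)) (sym (Inverse.strictlyInverseˡ f y)) e)

flip : Fin 2 → Fin 2
flip 0F = sucF 0F
flip (sucF 0F) = 0F

flip-≢ : ∀ a → a ≢ flip a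
flip-≢ 0F ()
flip-≢ (sucF 0F) ()

≢⇒≡flip : ∀ {a b : Fin 2} → a ≢ b → b ≡ flip a
≢⇒≡flip {0F} {0F} a≢b = contradiction refl a≢b
≢⇒≡flip {0F} {sucF 0F} _ = refl
≢⇒≡flip {sucF 0F} {0F} _ = refl
≢⇒≡flip {sucF 0F} {sucF 0F} a≢b = contradiction refl a≢b

flip-involutive : ∀ a → flip (flip a) ≡ a
flip-involutive 0F = refl
flip-involutive (sucF 0F) = refl

flip^ : ℕ → Fin 2 → Fin 2
flip^ zero a = a
flip^ (suc k) a = flip (flip^ k a)

flip^-even : ∀ k a → flip^ (2 * k) a ≡ a
flip^-even zero a = refl
flip^-even (suc k) a = begin
  flip^ (2 * suc k) a              ≡⟨ cong (λ i → flip^ i a) (ℕ.+-suc (suc k) (k + 0)) ⟩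
  flip (flip (flip^ (2 * k) a))    ≡⟨ flip-involutive _ ⟩
  flip^ (2 * k) a                  ≡⟨ flip^-even k a ⟩
  a                                ∎
  where open ≡-Reasoning

parity : ℕ → Fin 2
parity k = flip^ k 0F

-- Two colours alternate along the path 0, 1, …, k - 1, so its ends get the same colour when k is odd.
odd-cycle-not-2-colorable : ∀ {k} → Odd k → (col : Fin k → Fin 2) →
                            ¬ (∀ i j → Next k (toℕ i) (toℕ j) → col i ≢ col j)
odd-cycle-not-2-colorable {k} (j , refl) col col-proper =
  col-proper last first (inj₂ (last+1≡k , Fin.toℕ-fromℕ< 0<k)) (trans (alternates (2 * j) 2j<k) (flip^-even j _))
  where
  0<k = ℕ.m≤n+m 1 (2 * j)
  2j<k = subst (2 * j <_) (ℕ.+-comm 1 (2 * j)) (ℕ.n<1+n (2 * j))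
  first = fromℕ< 0<k
  last = fromℕ< 2j<k
  last+1≡k : suc (toℕ last) ≡ k
  last+1≡k = trans (cong suc (Fin.toℕ-fromℕ< 2j<k)) (ℕ.+-comm 1 (2 * j))
  alternates : ∀ x (x<k : x < k) → col (fromℕ< x<k) ≡ flip^ x (col first)
  alternates zero x<k = refl
  alternates (suc x) 1+x<k = trans
    (≢⇒≡flip (col-proper (fromℕ< x<k) (fromℕ< 1+x<k)
      (inj₁ (trans (cong suc (Fin.toℕ-fromℕ< x<k)) (sym (Fin.toℕ-fromℕ< 1+x<k))))))
    (cong flip (alternates x x<k))
    where
    x<k = ℕ.<-trans (ℕ.n<1+n x) 1+x<k

hasOddCycle⇒¬2-colorable : ∀ {G k} → Odd k → HasCycle G k → ¬ Colorable G 2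
hasOddCycle⇒¬2-colorable k-odd (_ , c , _ , c-edges) (col , col-proper) =
  odd-cycle-not-2-colorable k-odd (col ∘ c) λ i j next → col-proper (c i) (c j) (c-edges i j next)

chromatic-number-≥3 : ∀ {G} → ¬ Colorable G 2 → ∀ j → Colorable G j → 3 ≤ j
chromatic-number-≥3 ¬2-colorable j j-colorable with 3 ℕ.≤? j
... | yes 3≤j = 3≤j
... | no 3≰j = contradiction (colorable-mono (ℕ.s≤s⁻¹ (ℕ.≰⇒> 3≰j)) j-colorable) ¬2-colorable

missing-vertex : ∀ {k m} (c : Fin k → Fin m) → Injective _≡_ _≡_ c → k < m → ∃[ v ] ∀ i → c i ≢ v
missing-vertex {k} {m} c c-injective k<m
  with Fin.¬∀⟶∃¬ m (λ v → ∃[ i ] c i ≡ v) (λ v → Fin.any? (λ i → c i Fin.≟ v)) ¬surjective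
  where
  ¬surjective : ¬ (∀ v → ∃[ i ] c i ≡ v)
  ¬surjective preimage with Fin.pigeonhole k<m (proj₁ ∘ preimage)
  ... | v , v′ , v<v′ , same-preimage = ℕ.<-irrefl (cong toℕ v≡v′) v<v′
    where
    v≡v′ : v ≡ v′
    v≡v′ = trans (sym (proj₂ (preimage v))) (trans (cong c same-preimage) (proj₂ (preimage v′)))
... | v , ¬hit = v , λ i ci≡v → ¬hit (i , ci≡v)

module OddCycle (n : ℕ) (0<n : 0 < n) where

  m = 2 * n + 1

  private
    m≡1+2n : m ≡ suc (2 * n)
    m≡1+2n = ℕ.+-comm (2 * n) 1

  3≤m : 3 ≤ m
  3≤m = subst (3 ≤_) (sym m≡1+2n) (s≤s (ℕ.+-mono-≤ 0<n (ℕ.≤-trans 0<n (ℕ.m≤m+n n 0))))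

  private
    1≢m : 1 ≢ m
    1≢m 1≡m = ℕ.<-irrefl 1≡m (ℕ.<-≤-trans (s≤s (s≤s z≤n)) 3≤m)
    next-of-last : ∀ a → suc a ≡ m → a ≡ 2 * n
    next-of-last a 1+a≡m = ℕ.suc-injective (trans 1+a≡m m≡1+2n)

  hasCycle : HasCycle (Cyc m) m
  hasCycle = 3≤m , (λ i → i) , (λ eq → eq) , λ i j next → Equivalence.from (cycle-edge⇔next i j) (inj₁ next)

  not-2-colorable : ¬ Colorable (Cyc m) 2
  not-2-colorable = hasOddCycle⇒¬2-colorable (n , refl) hasCycle

  colourℕ : ℕ → Fin 3
  colourℕ a with suc a ℕ.≟ m
  ... | yes _ = fromℕ 2
  ... | no  _ = inject₁ (parity a)

  colourℕ-last : ∀ {a} → suc a ≡ m → colourℕ a ≡ fromℕ 2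
  colourℕ-last {a} 1+a≡m with suc a ℕ.≟ m
  ... | yes _ = refl
  ... | no 1+a≢m = contradiction 1+a≡m 1+a≢m

  colourℕ-other : ∀ {a} → suc a ≢ m → colourℕ a ≡ inject₁ (parity a)
  colourℕ-other {a} 1+a≢m with suc a ℕ.≟ m
  ... | yes 1+a≡m = contradiction 1+a≡m 1+a≢m
  ... | no _ = refl

  colourℕ-next : ∀ {a b} → b < m → Next m a b → colourℕ a ≢ colourℕ b
  colourℕ-next {a} {b} b<m (inj₁ refl) = by-cases (suc b ℕ.≟ m)
    where
    a-colour : colourℕ a ≡ inject₁ (parity a)
    a-colour = colourℕ-other (ℕ.<⇒≢ b<m)
    by-cases : Dec (suc b ≡ m) → colourℕ a ≢ colourℕ b
    by-cases (yes 1+b≡m) eq = Fin.fromℕ≢inject₁ (sym (trans (sym a-colour) (trans eq (colourℕ-last 1+b≡m))))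
    by-cases (no 1+b≢m) eq =
      flip-≢ (parity a) (Fin.inject₁-injective (trans (sym a-colour) (trans eq (colourℕ-other 1+b≢m))))
  colourℕ-next {a} b<m (inj₂ (1+a≡m , refl)) = λ eq → Fin.fromℕ≢inject₁
    (trans (sym (colourℕ-last 1+a≡m)) (trans eq (colourℕ-other 1≢m)))

  3-colorable : Colorable (Cyc m) 3
  3-colorable = colourℕ ∘ toℕ , λ x y x~y → proper x y (Equivalence.to (cycle-edge⇔next x y) x~y)
    where
    proper : ∀ x y → Next m (toℕ x) (toℕ y) ⊎ Next m (toℕ y) (toℕ x) → colourℕ (toℕ x) ≢ colourℕ (toℕ y)
    proper x y (inj₁ next) = colourℕ-next (Fin.toℕ<n y) next
    proper x y (inj₂ next) = colourℕ-next (Fin.toℕ<n x) next ∘ sym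

  chromatic-number : IsChromaticNumber (Cyc m) 3
  chromatic-number = 3-colorable , chromatic-number-≥3 not-2-colorable

  -- Deleting a vertex w leaves a path; colour it by parity, shifted by one before w.
  avoidingℕ : ℕ → ℕ → Fin 2
  avoidingℕ w a with a ℕ.<? w
  ... | yes _ = parity (suc a)
  ... | no  _ = parity a

  avoidingℕ-< : ∀ {w a} → a < w → avoidingℕ w a ≡ parity (suc a)
  avoidingℕ-< {w} {a} a<w with a ℕ.<? w
  ... | yes _ = refl
  ... | no a≮w = contradiction a<w a≮w

  avoidingℕ-≮ : ∀ {w a} → ¬ a < w → avoidingℕ w a ≡ parity a
  avoidingℕ-≮ {w} {a} a≮w with a ℕ.<? w
  ... | yes a<w = contradiction a<w a≮w
  ... | no _ = refl

  avoidingℕ-next : ∀ {w a b} → w < m → a ≢ w → b ≢ w → Next m a b → avoidingℕ w a ≢ avoidingℕ w b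
  avoidingℕ-next {w} {a} _ a≢w b≢w (inj₁ refl) = by-cases (a ℕ.<? w)
    where
    by-cases : Dec (a < w) → avoidingℕ w a ≢ avoidingℕ w (suc a)
    by-cases (yes a<w) eq = flip-≢ (parity (suc a))
      (trans (sym (avoidingℕ-< a<w)) (trans eq (avoidingℕ-< (ℕ.≤∧≢⇒< a<w b≢w))))
    by-cases (no a≮w) eq = flip-≢ (parity a)
      (trans (sym (avoidingℕ-≮ a≮w)) (trans eq (avoidingℕ-≮ (a≮w ∘ ℕ.<-trans (ℕ.n<1+n a)))))
  avoidingℕ-next {w} {a} w<m a≢w 0≢w (inj₂ (1+a≡m , refl)) eq = flip-≢ 0F (begin
    0F                    ≡⟨ flip^-even n 0F ⟨
    parity (2 * n)        ≡⟨ cong parity (next-of-last a 1+a≡m) ⟨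
    parity a              ≡⟨ avoidingℕ-≮ a≮w ⟨
    avoidingℕ w a         ≡⟨ eq ⟩
    avoidingℕ w 0         ≡⟨ avoidingℕ-< (ℕ.n≢0⇒n>0 (0≢w ∘ sym)) ⟩
    parity 1              ∎)
    where
    open ≡-Reasoning
    a≮w : ¬ a < w
    a≮w a<w = a≢w (ℕ.≤-antisym (ℕ.<⇒≤ a<w) (ℕ.s≤s⁻¹ (subst (w <_) (sym 1+a≡m) w<m)))

  avoiding-proper : ∀ (v x y : Fin m) → x ≢ v → y ≢ v → E (Cyc m) x y →
                    avoidingℕ (toℕ v) (toℕ x) ≢ avoidingℕ (toℕ v) (toℕ y)
  avoiding-proper v x y x≢v y≢v x~y with Equivalence.to (cycle-edge⇔next x y) x~y
  ... | inj₁ next = avoidingℕ-next (Fin.toℕ<n v) (x≢v ∘ Fin.toℕ-injective) (y≢v ∘ Fin.toℕ-injective) next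
  ... | inj₂ next = avoidingℕ-next (Fin.toℕ<n v) (y≢v ∘ Fin.toℕ-injective) (x≢v ∘ Fin.toℕ-injective) next ∘ sym

  oddGirth : IsOddGirth (Cyc m) m
  oddGirth = (n , refl) , hasCycle , shortest
    where
    shortest : ∀ k → Odd k → HasCycle (Cyc m) k → m ≤ k
    shortest k k-odd (_ , c , c-injective , c-edges) with m ℕ.≤? k
    ... | yes m≤k = m≤k
    ... | no m≰k with missing-vertex c c-injective (ℕ.≰⇒> m≰k)
    ...   | v , c≢v = contradiction (λ i j next → avoiding-proper v (c i) (c j) (c≢v i) (c≢v j) (c-edges i j next))
                        (odd-cycle-not-2-colorable k-odd (avoidingℕ (toℕ v) ∘ toℕ ∘ c))

-- Three-colourings of circular cliques

same-quotient⇒close : ∀ {q} .{{_ : NonZero q}} a b → a / q ≡ b / q → ∣ a - b ∣ < q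
same-quotient⇒close {q} a b a/q≡b/q = begin-strict
  ∣ a - b ∣                                   ≡⟨ cong₂ ∣_-_∣ (split a) (trans (split b) (cong (λ k → k * q + b % q) (sym a/q≡b/q))) ⟩
  ∣ a / q * q + a % q - a / q * q + b % q ∣    ≡⟨ ℕ.∣m+n-m+o∣≡∣n-o∣ (a / q * q) (a % q) (b % q) ⟩
  ∣ a % q - b % q ∣                           ≤⟨ ℕ.∣m-n∣≤m⊔n (a % q) (b % q) ⟩
  a % q ⊔ b % q                               <⟨ ℕ.⊔-lub (m%n<n a q) (m%n<n b q) ⟩
  q                                           ∎
  where
  open ℕ.≤-Reasoning
  split : ∀ x → x ≡ x / q * q + x % q
  split x = trans (m≡m%n+[m/n]*n x q) (ℕ.+-comm (x % q) _)

circK-3-colorable : ∀ {p q} → 0 < q → p ≤ 3 * q → Colorable (CircK p q) 3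
circK-3-colorable {p} {q} 0<q p≤3q = band , proper
  where
  instance
    q-nonZero : NonZero q
    q-nonZero = ℕ.>-nonZero 0<q
  band : Fin p → Fin 3
  band x = fromℕ< (m<n*o⇒m/o<n (ℕ.<-≤-trans (Fin.toℕ<n x) p≤3q))
  proper : ∀ x y → E (CircK p q) x y → band x ≢ band y
  proper x y (q≤∣x-y∣ , _) same-band = ℕ.<⇒≱ (same-quotient⇒close (toℕ x) (toℕ y)
    (trans (sym (Fin.toℕ-fromℕ< _)) (trans (cong toℕ same-band) (Fin.toℕ-fromℕ< _)))) q≤∣x-y∣

private
  pattern 1F = sucF 0F
  pattern 2F = sucF (sucF 0F)

third-colour : (a b : Fin 3) → a ≢ b → ∃[ c ] ∀ d → d ≢ a → d ≢ b → d ≡ c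
third-colour 0F 0F a≢b = contradiction refl a≢b
third-colour 0F 1F _ = 2F , λ { 0F d≢a _ → contradiction refl d≢a ; 1F _ d≢b → contradiction refl d≢b ; 2F _ _ → refl }
third-colour 0F 2F _ = 1F , λ { 0F d≢a _ → contradiction refl d≢a ; 1F _ _ → refl ; 2F _ d≢b → contradiction refl d≢b }
third-colour 1F 0F _ = 2F , λ { 0F _ d≢b → contradiction refl d≢b ; 1F d≢a _ → contradiction refl d≢a ; 2F _ _ → refl }
third-colour 1F 1F a≢b = contradiction refl a≢b
third-colour 1F 2F _ = 0F , λ { 0F _ _ → refl ; 1F d≢a _ → contradiction refl d≢a ; 2F _ d≢b → contradiction refl d≢b }
third-colour 2F 0F _ = 1F , λ { 0F _ d≢b → contradiction refl d≢b ; 1F _ _ → refl ; 2F d≢a _ → contradiction refl d≢a }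
third-colour 2F 1F _ = 0F , λ { 0F _ _ → refl ; 1F _ d≢b → contradiction refl d≢b ; 2F d≢a _ → contradiction refl d≢a }
third-colour 2F 2F a≢b = contradiction refl a≢b

forced-colour : ∀ {a b c d : Fin 3} → a ≢ b → c ≢ a → c ≢ b → d ≢ a → d ≢ b → d ≡ c
forced-colour {a} {b} {c} {d} a≢b c≢a c≢b d≢a d≢b with third-colour a b a≢b
... | e , unique = trans (unique d d≢a d≢b) (sym (unique c c≢a c≢b))

-- In a 3-colouring of K_{p/q} with 3q < p, the triangle x, x + q, x + 2q forces
-- x + 2q + 1, then x + q + 1, then x + 1 to repeat the colours of x + 2q, x + q, x;
-- so 0 and q get the same colour although they are adjacent.
circK-not-3-colorable : ∀ {p q} → 0 < q → 3 * q < p → ¬ Colorable (CircK p q) 3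
circK-not-3-colorable {p} {q@(suc q′)} _ 3q<p (c , c-proper) =
  apart 0 q q refl q<p ℕ.≤-refl (ℕ.≤-trans (ℕ.m≤m+n q q) (ℕ.n≤1+n _)) (sym (col-constant q ℕ.≤-refl))
  where
  col : ℕ → Fin 3
  col a with a ℕ.<? p
  ... | yes a<p = c (fromℕ< a<p)
  ... | no  _   = 0F

  col-fromℕ< : ∀ {a} (a<p : a < p) → col a ≡ c (fromℕ< a<p)
  col-fromℕ< {a} a<p with a ℕ.<? p
  ... | yes _ = refl
  ... | no a≮p = contradiction a<p a≮p

  3q+1≤p : suc (q + q + q) ≤ p
  3q+1≤p = subst (_< p) (lemma q) 3q<p
    where
    lemma : ∀ q → 3 * q ≡ q + q + q
    lemma = ℕ-Solver.solve-∀

  q<p : q < p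
  q<p = ℕ.≤-<-trans (ℕ.≤-trans (ℕ.m≤m+n q q) (ℕ.m≤m+n (q + q) q)) 3q+1≤p

  apart : ∀ a d b → a + d ≡ b → b < p → q ≤ d → d ≤ suc (q + q) → col a ≢ col b
  apart a d b refl b<p q≤d d≤2q+1 same = c-proper (fromℕ< a<p) (fromℕ< b<p) (q≤∣a-b∣ , ∣a-b∣≤p∸q)
    (trans (sym (col-fromℕ< a<p)) (trans same (col-fromℕ< b<p)))
    where
    a<p = ℕ.≤-<-trans (ℕ.m≤m+n a d) b<p
    ∣a-b∣≡d : ∣ toℕ (fromℕ< a<p) - toℕ (fromℕ< b<p) ∣ ≡ d
    ∣a-b∣≡d = trans (cong₂ ∣_-_∣ (Fin.toℕ-fromℕ< a<p) (Fin.toℕ-fromℕ< b<p)) (ℕ.∣m-m+n∣≡n a d)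
    q≤∣a-b∣ = subst (q ≤_) (sym ∣a-b∣≡d) q≤d
    ∣a-b∣≤p∸q = subst (_≤ p ∸ q) (sym ∣a-b∣≡d) (ℕ.m+n≤o⇒m≤o∸n d (ℕ.≤-trans (ℕ.+-monoˡ-≤ q d≤2q+1) 3q+1≤p))

  slide : ∀ x → suc (x + q + q) < p → col (suc x) ≡ col x
  slide x top<p = A′≡A
    where
    C<p = ℕ.<-trans (ℕ.n<1+n _) top<p
    B<p = ℕ.≤-<-trans (ℕ.m≤m+n (x + q) q) C<p
    A<p = ℕ.≤-<-trans (ℕ.m≤m+n x q) B<p
    B′<p = ℕ.≤-<-trans (s≤s (ℕ.m≤m+n (x + q) q)) top<p
    A′<p = ℕ.≤-<-trans (s≤s (ℕ.m≤m+n x q)) B′<p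
    q≤2q = ℕ.m≤m+n q q
    q≤1+q = ℕ.n≤1+n q
    q≤2q+1 = ℕ.≤-trans q≤2q (ℕ.n≤1+n _)
    A≢B : col x ≢ col (x + q)
    A≢B = apart x q _ refl B<p ℕ.≤-refl q≤2q+1
    A≢C : col x ≢ col (x + q + q)
    A≢C = apart x (q + q) _ (sym (ℕ.+-assoc x q q)) C<p q≤2q (ℕ.n≤1+n _)
    B≢C : col (x + q) ≢ col (x + q + q)
    B≢C = apart (x + q) q _ refl C<p ℕ.≤-refl q≤2q+1
    C′≡C : col (suc (x + q + q)) ≡ col (x + q + q)
    C′≡C = forced-colour A≢B (A≢C ∘ sym) (B≢C ∘ sym)
      (apart x (suc (q + q)) _ (trans (ℕ.+-suc x (q + q)) (cong suc (sym (ℕ.+-assoc x q q)))) top<p q≤2q+1 ℕ.≤-refl ∘ sym)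
      (apart (x + q) (suc q) _ (ℕ.+-suc (x + q) q) top<p q≤1+q (s≤s q≤2q) ∘ sym)
    B′≡B : col (suc (x + q)) ≡ col (x + q)
    B′≡B = forced-colour A≢C (A≢B ∘ sym) B≢C
      (apart x (suc q) _ (ℕ.+-suc x q) B′<p q≤1+q (s≤s q≤2q) ∘ sym)
      (λ B′≡C → apart (suc (x + q)) q _ refl top<p ℕ.≤-refl q≤2q+1 (trans B′≡C (sym C′≡C)))
    A′≡A : col (suc x) ≡ col x
    A′≡A = forced-colour B≢C A≢B A≢C
      (λ A′≡B → apart (suc x) q _ refl B′<p ℕ.≤-refl q≤2q+1 (trans A′≡B (sym B′≡B)))
      (apart (suc x) (q + q′) _ (lemma x q′) C<p (ℕ.m≤m+n q q′) (ℕ.≤-trans (ℕ.+-monoʳ-≤ q (ℕ.n≤1+n q′)) (ℕ.n≤1+n _)))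
      where
      lemma : ∀ x q′ → suc x + (suc q′ + q′) ≡ x + suc q′ + suc q′
      lemma = ℕ-Solver.solve-∀

  col-constant : ∀ x → x ≤ q → col x ≡ col 0
  col-constant zero _ = refl
  col-constant (suc x) 1+x≤q =
    trans (slide x (ℕ.≤-trans (s≤s (ℕ.+-monoˡ-≤ q (ℕ.+-monoˡ-≤ q 1+x≤q))) 3q+1≤p)) (col-constant x (ℕ.<⇒≤ 1+x≤q))

oddCyclePower≅circularClique : ∀ n t → t < n →
  Power (Cyc (2 * n + 1)) (2 * t + 1) ≅ CircK (2 * n + 1) (n ∸ t)
oddCyclePower≅circularClique n t t<n =
  subst (λ k → Power (Cyc (2 * k + 1)) (2 * t + 1) ≅ CircK (2 * k + 1) (n ∸ t))
        (ℕ.m+[n∸m]≡n (ℕ.<⇒≤ t<n))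
        (Scaling.oddCyclePower≅circularClique t (n ∸ t) (ℕ.m<n⇒0<n∸m t<n))

private
  module _ (t q : ℕ) where
    clique-bound⇔ : 2 * (t + q) + 1 ≤ 3 * q ⇔ (2 * t + 1) ≤ q
    clique-bound⇔ = mk⇔
      (λ h → ℕ.+-cancelʳ-≤ (2 * q) (2 * t + 1) q (subst₂ _≤_ (e₁ t q) (e₂ q) h))
      (λ h → subst₂ _≤_ (sym (e₁ t q)) (sym (e₂ q)) (ℕ.+-monoˡ-≤ (2 * q) h))
      where
      e₁ : ∀ t q → 2 * (t + q) + 1 ≡ 2 * t + 1 + 2 * q
      e₁ = ℕ-Solver.solve-∀
      e₂ : ∀ q → 3 * q ≡ q + 2 * q
      e₂ = ℕ-Solver.solve-∀

    power-bound⇔ : 3 * (2 * t + 1) ≤ 2 * (t + q) + 1 ⇔ (2 * t + 1) ≤ q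
    power-bound⇔ = mk⇔
      (λ h → ℕ.*-cancelˡ-≤ 2 (ℕ.+-cancelʳ-≤ (2 * t + 1) (2 * (2 * t + 1)) (2 * q) (subst₂ _≤_ (e₃ t) (e₄ t q) h)))
      (λ h → subst₂ _≤_ (sym (e₃ t)) (sym (e₄ t q)) (ℕ.+-monoˡ-≤ (2 * t + 1) (ℕ.*-monoʳ-≤ 2 h)))
      where
      e₃ : ∀ t → 3 * (2 * t + 1) ≡ 2 * (2 * t + 1) + (2 * t + 1)
      e₃ = ℕ-Solver.solve-∀
      e₄ : ∀ t q → 2 * (t + q) + 1 ≡ 2 * q + (2 * t + 1)
      e₄ = ℕ-Solver.solve-∀

oddCyclePower-3-colorable⇔ : ∀ n t → t < n →
  Colorable (Power (Cyc (2 * n + 1)) (2 * t + 1)) 3 ⇔ 3 * (2 * t + 1) ≤ 2 * n + 1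
oddCyclePower-3-colorable⇔ n t t<n = mk⇔ to from
  where
  q = n ∸ t
  0<q = ℕ.m<n⇒0<n∸m t<n
  n≡t+q = sym (ℕ.m+[n∸m]≡n (ℕ.<⇒≤ t<n))
  iso = oddCyclePower≅circularClique n t t<n
  bounds⇔ : 2 * n + 1 ≤ 3 * q ⇔ 3 * (2 * t + 1) ≤ 2 * n + 1
  bounds⇔ = subst (λ k → 2 * k + 1 ≤ 3 * q ⇔ 3 * (2 * t + 1) ≤ 2 * k + 1) (sym n≡t+q)
    (⇔-sym (power-bound⇔ t q) ⇔-∘ clique-bound⇔ t q)
  to : Colorable (Power (Cyc (2 * n + 1)) (2 * t + 1)) 3 → 3 * (2 * t + 1) ≤ 2 * n + 1
  to col = Equivalence.to bounds⇔ (ℕ.≮⇒≥ λ 3q<p → circK-not-3-colorable 0<q 3q<p (≅-colorable⁻ iso col))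
  from : 3 * (2 * t + 1) ≤ 2 * n + 1 → Colorable (Power (Cyc (2 * n + 1)) (2 * t + 1)) 3
  from h = ≅-colorable iso (circK-3-colorable 0<q (Equivalence.from bounds⇔ h))

-- Subdivided cycles

divmod-unique : ∀ {S} .{{_ : NonZero S}} a {b} → b < S → (b + a * S) / S ≡ a × (b + a * S) % S ≡ b
divmod-unique {S} a {b} b<S =
  trans (+-distrib-/-∣ʳ b (n∣m*n a)) (cong₂ _+_ (m<n⇒m/n≡0 b<S) (m*n/n≡m a S)) ,
  trans ([m+kn]%n≡m%n b a S) (m<n⇒m%n≡m b<S)

cycle-hom : ∀ {N H} (f : ℕ → V H) → (∀ x y → E H x y → E H y x) →
            (∀ x → suc x < N → E H (f x) (f (suc x))) → E H (f (N ∸ 1)) (f 0) → Hom (Cyc N) H (f ∘ toℕ)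
cycle-hom {N} {H} f H-sym f-step f-wrap x y x~y =
  [ (λ next → along next (Fin.toℕ<n y)) , (λ next → H-sym _ _ (along next (Fin.toℕ<n x))) ]
    (Equivalence.to (cycle-edge⇔next x y) x~y)
  where
  along : ∀ {a b} → Next N a b → b < N → E H (f a) (f b)
  along (inj₁ refl) b<N = f-step _ b<N
  along (inj₂ (refl , refl)) _ = f-wrap

module SubdividedCycle (m S′ : ℕ) (1<m : 1 < m) where

  S = suc S′
  N = S * m
  C = Cycle m

  instance
    N-nonZero : NonZero N
    N-nonZero = ℕ.m*n≢0 S m {{_}} {{ℕ.>-nonZero (ℕ.<-trans (s≤s z≤n) 1<m)}}

  low high : EdgeOf C → Fin m
  low = proj₁
  high = proj₁ ∘ proj₂

  pos-end : ∀ e → pos C S e S ≡ inj₁ (high e)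
  pos-end e with S′ ℕ.<? S′
  ... | yes S′<S′ = contradiction S′<S′ (ℕ.<-irrefl refl)
  ... | no _ = refl

  pos-inner : ∀ e {k} (k<S′ : k < S′) → pos C S e (suc k) ≡ inj₂ (e , fromℕ< k<S′)
  pos-inner e {k} k<S′ with k ℕ.<? S′
  ... | yes _ = refl
  ... | no k≮S′ = contradiction k<S′ k≮S′

  pos-last : ∀ e {k} → ¬ k < S′ → k ≤ S′ → pos C S e (suc k) ≡ inj₁ (high e)
  pos-last e {k} k≮S′ k≤S′ = subst (λ i → pos C S e (suc i) ≡ inj₁ (high e))
    (ℕ.≤-antisym (ℕ.≮⇒≥ k≮S′) k≤S′) (pos-end e)

  Forward : EdgeOf C → Set
  Forward e = suc (toℕ (low e)) ≡ toℕ (high e)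

  ¬forward⇒wrap : ∀ e → ¬ Forward e → toℕ (low e) ≡ 0 × suc (toℕ (high e)) ≡ m
  ¬forward⇒wrap (u , v , u<v , u~v) ¬forward with Equivalence.to (cycle-edge⇔next u v) u~v
  ... | inj₁ (inj₁ forward) = contradiction forward ¬forward
  ... | inj₁ (inj₂ (_ , v≡0)) = contradiction (subst (toℕ u <_) v≡0 u<v) λ ()
  ... | inj₂ (inj₁ 1+v≡u) = contradiction (subst (_< toℕ v) (sym 1+v≡u) u<v) (ℕ.<-asym (ℕ.n<1+n _))
  ... | inj₂ (inj₂ (1+v≡m , u≡0)) = u≡0 , 1+v≡m

  -- Forward paths are laid out as S u, S u + 1, …, S u + S; the path of the wrap-around
  -- edge {0, m - 1} as 0, -1, …, -S ≡ S (m - 1).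
  φℤ : SubV C S → ℤ
  φℤ (inj₁ u) = + (S * toℕ u)
  φℤ (inj₂ (e , p)) with suc (toℕ (low e)) ℕ.≟ toℕ (high e)
  ... | yes _ = + (S * toℕ (low e) + suc (toℕ p))
  ... | no _  = -ᶻ + suc (toℕ p)

  φ : SubV C S → Fin N
  φ = residue ∘ φℤ

  φℤ-inner-forward : ∀ e p → Forward e → φℤ (inj₂ (e , p)) ≡ + (S * toℕ (low e) + suc (toℕ p))
  φℤ-inner-forward e p forward with suc (toℕ (low e)) ℕ.≟ toℕ (high e)
  ... | yes _ = refl
  ... | no ¬forward = contradiction forward ¬forward

  φℤ-inner-wrap : ∀ e p → ¬ Forward e → φℤ (inj₂ (e , p)) ≡ -ᶻ + suc (toℕ p)
  φℤ-inner-wrap e p ¬forward with suc (toℕ (low e)) ℕ.≟ toℕ (high e)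
  ... | yes forward = contradiction forward ¬forward
  ... | no _ = refl

  φℤ-forward : ∀ e → Forward e → ∀ k → k ≤ S → φℤ (pos C S e k) ≡ + (S * toℕ (low e) + k)
  φℤ-forward e forward zero _ = cong +_ (sym (ℕ.+-identityʳ _))
  φℤ-forward e forward (suc k) 1+k≤S = by-cases (k ℕ.<? S′)
    where
    by-cases : Dec (k < S′) → φℤ (pos C S e (suc k)) ≡ + (S * toℕ (low e) + suc k)
    by-cases (yes k<S′) = trans (cong φℤ (pos-inner e k<S′)) (trans (φℤ-inner-forward e _ forward)
                     (cong (λ i → + (S * toℕ (low e) + suc i)) (Fin.toℕ-fromℕ< k<S′)))
    by-cases (no k≮S′) = begin
      φℤ (pos C S e (suc k))        ≡⟨ cong φℤ (pos-last e k≮S′ (ℕ.s≤s⁻¹ 1+k≤S)) ⟩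
      + (S * toℕ (high e))            ≡⟨ cong (λ v → + (S * v)) forward ⟨
      + (S * suc (toℕ (low e)))    ≡⟨ cong +_ (ℕ.*-suc S (toℕ (low e))) ⟩
      + (S + S * toℕ (low e))      ≡⟨ cong +_ (ℕ.+-comm S _) ⟩
      + (S * toℕ (low e) + S)      ≡⟨ cong (λ i → + (S * toℕ (low e) + suc i)) (ℕ.≤-antisym (ℕ.s≤s⁻¹ 1+k≤S) (ℕ.≮⇒≥ k≮S′)) ⟨
      + (S * toℕ (low e) + suc k)  ∎
      where open ≡-Reasoning

  φℤ-wrap : ∀ e → ¬ Forward e → ∀ k → k ≤ S → φℤ (pos C S e k) ≡ -ᶻ + k mod N
  φℤ-wrap e ¬forward zero _ =
    ≡⇒≡-mod (trans (cong (λ u → + (S * u)) (proj₁ (¬forward⇒wrap e ¬forward))) (cong +_ (ℕ.*-zeroʳ S)))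
  φℤ-wrap e ¬forward (suc k) 1+k≤S = by-cases (k ℕ.<? S′)
    where
    by-cases : Dec (k < S′) → φℤ (pos C S e (suc k)) ≡ -ᶻ + suc k mod N
    by-cases (yes k<S′) = ≡⇒≡-mod (trans (cong φℤ (pos-inner e k<S′)) (trans (φℤ-inner-wrap e _ ¬forward)
                     (cong (λ i → -ᶻ + suc i) (Fin.toℕ-fromℕ< k<S′))))
    by-cases (no k≮S′) = ≡-mod-by (+ 1) (begin
      φℤ (pos C S e (suc k))        ≡⟨ cong φℤ (pos-last e k≮S′ (ℕ.s≤s⁻¹ 1+k≤S)) ⟩
      + (S * v)                     ≡⟨ lemma (+ (S * v)) (+ S) ⟩
      -ᶻ + S +ᶻ + 1 *ᶻ + (S * v + S) ≡⟨ cong₂ (λ i n → -ᶻ + suc i +ᶻ + 1 *ᶻ + n) S′≡k Sv+S≡N ⟩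
      -ᶻ + suc k +ᶻ + 1 *ᶻ + N      ∎)
      where
      open ≡-Reasoning
      v = toℕ (high e)
      S′≡k = ℕ.≤-antisym (ℕ.≮⇒≥ k≮S′) (ℕ.s≤s⁻¹ 1+k≤S)
      Sv+S≡N : S * v + S ≡ N
      Sv+S≡N = trans (ℕ.+-comm (S * v) S) (trans (sym (ℕ.*-suc S v)) (cong (S *_) (proj₂ (¬forward⇒wrap e ¬forward))))
      lemma : ∀ a s → a ≡ -ᶻ s +ᶻ + 1 *ᶻ (a +ᶻ s)
      lemma = solve-∀

  φ-edge : ∀ e k → k < S → E (Cyc N) (φ (pos C S e k)) (φ (pos C S e (suc k)))
  φ-edge e k k<S = Equivalence.from (cycle-edge⇔step _ _) (by-cases (suc (toℕ (low e)) ℕ.≟ toℕ (high e)))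
    where
    open ≡-mod-Reasoning N
    x = pos C S e k
    y = pos C S e (suc k)
    by-cases : Dec (Forward e) → Step (φ x) (φ y) ⊎ Step (φ y) (φ x)
    by-cases (yes forward) = inj₁ $ begin
      + toℕ (φ y)                         ≈⟨ residue-≡-mod (φℤ y) ⟩
      φℤ y                                ≡⟨ φℤ-forward e forward (suc k) k<S ⟩
      + (S * toℕ (low e) + suc k)        ≡⟨ cong +_ (trans (ℕ.+-suc _ k) (ℕ.+-comm 1 _)) ⟩
      + (S * toℕ (low e) + k) +ᶻ + 1     ≡⟨ cong (_+ᶻ + 1) (φℤ-forward e forward k (ℕ.<⇒≤ k<S)) ⟨
      φℤ x +ᶻ + 1                         ≈⟨ +-congʳ-≡-mod (+ 1) (residue-≡-mod (φℤ x)) ⟨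
      + toℕ (φ x) +ᶻ + 1                  ∎
    by-cases (no ¬forward) = inj₂ $ begin
      + toℕ (φ x)                         ≈⟨ residue-≡-mod (φℤ x) ⟩
      φℤ x                                ≈⟨ φℤ-wrap e ¬forward k (ℕ.<⇒≤ k<S) ⟩
      -ᶻ + k                              ≡⟨ lemma (+ k) ⟩
      -ᶻ (+ 1 +ᶻ + k) +ᶻ + 1              ≈⟨ +-congʳ-≡-mod (+ 1) (φℤ-wrap e ¬forward (suc k) k<S) ⟨
      φℤ y +ᶻ + 1                         ≈⟨ +-congʳ-≡-mod (+ 1) (residue-≡-mod (φℤ y)) ⟨
      + toℕ (φ y) +ᶻ + 1                  ∎
      where
      lemma : ∀ k → -ᶻ k ≡ -ᶻ (+ 1 +ᶻ k) +ᶻ + 1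
      lemma = solve-∀

  φ-hom : Hom (Subdiv S C) (Cyc N) φ
  φ-hom x y (e , k , k<S , inj₁ (refl , refl)) = φ-edge e k k<S
  φ-hom x y (e , k , k<S , inj₂ (refl , refl)) = cycle-edge-sym (φ y) (φ x) (φ-edge e k k<S)

  subdivision-edge : ∀ e k → k < S → E (Subdiv S C) (pos C S e k) (pos C S e (suc k))
  subdivision-edge e k k<S = e , k , k<S , inj₁ (refl , refl)

  subdivision-edge-sym : ∀ x y → E (Subdiv S C) x y → E (Subdiv S C) y x
  subdivision-edge-sym x y (e , k , k<S , inj₁ (p , q)) = e , k , k<S , inj₂ (q , p)
  subdivision-edge-sym x y (e , k , k<S , inj₂ (p , q)) = e , k , k<S , inj₁ (q , p)

  private
    0<m : 0 < m
    0<m = ℕ.<-trans (s≤s z≤n) 1<m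
    m-1<m : m ∸ 1 < m
    m-1<m = ℕ.∸-monoʳ-< (s≤s z≤n) (ℕ.<⇒≤ 1<m)
    1+[m-1]≡m : suc (m ∸ 1) ≡ m
    1+[m-1]≡m = ℕ.m+[n∸m]≡n {1} (ℕ.<⇒≤ 1<m)

  forward-edge : ∀ a → .(suc a < m) → EdgeOf C
  forward-edge a 1+a<m = fromℕ< (ℕ.<-trans (ℕ.n<1+n a) 1+a<m) , fromℕ< 1+a<m ,
    subst₂ _<_ (sym (Fin.toℕ-fromℕ< _)) (sym (Fin.toℕ-fromℕ< 1+a<m)) (ℕ.n<1+n a) ,
    Equivalence.from (cycle-edge⇔next _ _) (inj₁ (inj₁ (trans (cong suc (Fin.toℕ-fromℕ< _)) (sym (Fin.toℕ-fromℕ< 1+a<m)))))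

  wrap-around : EdgeOf C
  wrap-around = fromℕ< 0<m , fromℕ< m-1<m ,
    subst₂ _<_ (sym (Fin.toℕ-fromℕ< 0<m)) (sym (Fin.toℕ-fromℕ< m-1<m)) (ℕ.m<n⇒0<n∸m 1<m) ,
    Equivalence.from (cycle-edge⇔next _ _)
      (inj₂ (inj₂ (trans (cong suc (Fin.toℕ-fromℕ< m-1<m)) 1+[m-1]≡m , Fin.toℕ-fromℕ< 0<m)))

  -- Vertex b of block a of the long cycle: the b-th vertex of the path of edge {a, a + 1},
  -- or, for the last block, of the path of {0, m - 1} traversed backwards.
  block : ℕ → ℕ → SubV C S
  block a b with suc a ℕ.<? m
  ... | yes 1+a<m = pos C S (forward-edge a 1+a<m) b
  ... | no  _     = pos C S wrap-around (S ∸ b)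

  ψℕ : ℕ → SubV C S
  ψℕ x = block (x / S) (x % S)

  ψ : Fin N → SubV C S
  ψ = ψℕ ∘ toℕ

  block-forward : ∀ {a} b (1+a<m : suc a < m) → block a b ≡ pos C S (forward-edge a 1+a<m) b
  block-forward {a} b 1+a<m with suc a ℕ.<? m
  ... | yes _ = refl
  ... | no 1+a≮m = contradiction 1+a<m 1+a≮m

  block-last : ∀ {a} b → ¬ suc a < m → block a b ≡ pos C S wrap-around (S ∸ b)
  block-last {a} b 1+a≮m with suc a ℕ.<? m
  ... | yes 1+a<m = contradiction 1+a<m 1+a≮m
  ... | no _ = refl

  block-step : ∀ a b → suc b < S → E (Subdiv S C) (block a b) (block a (suc b))
  block-step a b 1+b<S with suc a ℕ.<? m
  ... | yes 1+a<m = subdivision-edge (forward-edge a 1+a<m) b (ℕ.<-trans (ℕ.n<1+n b) 1+b<S)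
  ... | no _ = subst (λ i → E (Subdiv S C) (pos C S wrap-around i) (pos C S wrap-around (S′ ∸ b)))
    (sym (ℕ.+-∸-assoc 1 (ℕ.<⇒≤ (ℕ.s≤s⁻¹ 1+b<S))))
    (subdivision-edge-sym _ _ (subdivision-edge wrap-around (S′ ∸ b) (s≤s (ℕ.m∸n≤m S′ b))))

  block-carry : ∀ a → suc a < m → E (Subdiv S C) (block a S′) (block (suc a) 0)
  block-carry a 1+a<m = subst₂ (E (Subdiv S C)) (sym (block-forward S′ 1+a<m)) (next-block (suc (suc a) ℕ.<? m))
    (subdivision-edge (forward-edge a 1+a<m) S′ (ℕ.n<1+n S′))
    where
    next-block : Dec (suc (suc a) < m) → pos C S (forward-edge a 1+a<m) S ≡ block (suc a) 0
    next-block (yes 2+a<m) = trans (pos-end _) (sym (block-forward 0 2+a<m))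
    next-block (no 2+a≮m) with suc (suc a) ℕ.<? m
    ... | yes 2+a<m = contradiction 2+a<m 2+a≮m
    ... | no _ = trans (pos-end _)
      (trans (cong inj₁ (Fin.fromℕ<-cong (suc a) (m ∸ 1) 1+a≡m-1 1+a<m m-1<m)) (sym (pos-end _)))
      where
      1+a≡m-1 : suc a ≡ m ∸ 1
      1+a≡m-1 = ℕ.suc-injective (trans (ℕ.≤-antisym 1+a<m (ℕ.≮⇒≥ 2+a≮m)) (sym 1+[m-1]≡m))

  block-wrap : E (Subdiv S C) (block (m ∸ 1) S′) (block 0 0)
  block-wrap = subst₂ (E (Subdiv S C)) last first (subdivision-edge-sym _ _ (subdivision-edge wrap-around 0 (s≤s z≤n)))
    where
    last : pos C S wrap-around 1 ≡ block (m ∸ 1) S′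
    last = sym (trans (block-last S′ (ℕ.<-irrefl 1+[m-1]≡m)) (cong (pos C S wrap-around) (ℕ.m+n∸n≡m 1 S′)))
    first : pos C S wrap-around 0 ≡ block 0 0
    first = sym (block-forward 0 1<m)

  ψℕ-block : ∀ a b → b < S → ψℕ (b + a * S) ≡ block a b
  ψℕ-block a b b<S = cong₂ block (proj₁ (divmod-unique a b<S)) (proj₂ (divmod-unique a b<S))

  ψ-hom : Hom (Cyc N) (Subdiv S C) ψ
  ψ-hom = cycle-hom ψℕ subdivision-edge-sym step wrap
    where
    step : ∀ x → suc x < N → E (Subdiv S C) (ψℕ x) (ψℕ (suc x))
    step x 1+x<N with suc (x % S) ℕ.<? S
    ... | yes 1+b<S = subst (E (Subdiv S C) (ψℕ x)) (sym ψ[1+x]) (block-step (x / S) (x % S) 1+b<S)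
      where
      ψ[1+x] : ψℕ (suc x) ≡ block (x / S) (suc (x % S))
      ψ[1+x] = trans (cong (ψℕ ∘ suc) (m≡m%n+[m/n]*n x S)) (ψℕ-block (x / S) (suc (x % S)) 1+b<S)
    ... | no 1+b≮S = subst₂ (E (Subdiv S C)) (cong (block (x / S)) (sym b≡S′)) (sym ψ[1+x]) (block-carry (x / S) 1+a<m)
      where
      b≡S′ : x % S ≡ S′
      b≡S′ = ℕ.suc-injective (ℕ.≤-antisym (m%n<n x S) (ℕ.≮⇒≥ 1+b≮S))
      1+x≡[1+a]S : suc x ≡ suc (x / S) * S
      1+x≡[1+a]S = trans (cong suc (m≡m%n+[m/n]*n x S)) (cong (λ b → suc b + x / S * S) b≡S′)
      ψ[1+x] : ψℕ (suc x) ≡ block (suc (x / S)) 0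
      ψ[1+x] = trans (cong ψℕ 1+x≡[1+a]S) (ψℕ-block (suc (x / S)) 0 (s≤s z≤n))
      1+a<m : suc (x / S) < m
      1+a<m = ℕ.*-cancelʳ-< S (suc (x / S)) m (subst₂ _<_ 1+x≡[1+a]S (ℕ.*-comm S m) 1+x<N)
    wrap : E (Subdiv S C) (ψℕ (N ∸ 1)) (ψℕ 0)
    wrap = subst₂ (E (Subdiv S C))
      (sym (trans (cong ψℕ N-1≡) (ψℕ-block (m ∸ 1) S′ (ℕ.n<1+n S′)))) (sym (ψℕ-block 0 0 (s≤s z≤n))) block-wrap
      where
      N-1≡ : N ∸ 1 ≡ S′ + (m ∸ 1) * S
      N-1≡ = cong (_∸ 1)
        (trans (cong (S *_) (sym 1+[m-1]≡m)) (trans (ℕ.*-suc S (m ∸ 1)) (cong (_+_ S) (ℕ.*-comm S (m ∸ 1)))))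

fracPower-cycle-colorable⇔ : ∀ {m} r s k → 1 < m →
  Colorable (FracPower (Cycle m) r s) k ⇔ Colorable (Power (Cyc ((2 * s + 1) * m)) (2 * r + 1)) k
fracPower-cycle-colorable⇔ {m} r s k 1<m =
  subst (λ S → Colorable (Power (Subdiv S (Cycle m)) (2 * r + 1)) k ⇔ Colorable (Power (Cyc (S * m)) (2 * r + 1)) k)
        (ℕ.+-comm 1 (2 * s))
        (mk⇔ (colorable-pullback ψ (power-hom (2 * r + 1) ψ ψ-hom))
             (colorable-pullback φ (power-hom (2 * r + 1) φ φ-hom)))
  where open SubdividedCycle m (2 * s) 1<m

-- θ of odd cycles

module ThetaOfOddCycle (n : ℕ) (0<n : 0 < n) where

  open OddCycle n 0<n

  private
    1<m : 1 < m
    1<m = ℕ.≤-trans (s≤s (s≤s z≤n)) 3≤m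

  admissible⇒bound : ∀ r s → ThetaAdmissible (Cycle m) r s → (2 * r + 1) * 3 ≤ m * (2 * s + 1)
  admissible⇒bound r s ((k , k-chromatic , k-colorable) , (g , g-oddGirth , ℓ<g[2s+1])) =
    subst₂ _≤_ (ℕ.*-comm 3 ℓ) (trans (sym N≡2M+1) (ℕ.*-comm (2 * s + 1) m))
      (Equivalence.to (oddCyclePower-3-colorable⇔ M r r<M) power-colorable)
    where
    ℓ = 2 * r + 1
    N = (2 * s + 1) * m
    M = 2 * n * s + n + s
    N≡2M+1 : N ≡ 2 * M + 1
    N≡2M+1 = lemma n s
      where
      lemma : ∀ n s → (2 * s + 1) * (2 * n + 1) ≡ 2 * (2 * n * s + n + s) + 1
      lemma = ℕ-Solver.solve-∀
    power-colorable : Colorable (Power (Cyc (2 * M + 1)) ℓ) 3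
    power-colorable = subst (λ K → Colorable (Power (Cyc K) ℓ) 3) N≡2M+1
      (Equivalence.to (fracPower-cycle-colorable⇔ r s 3 1<m)
        (colorable-mono (proj₂ k-chromatic 3 3-colorable) k-colorable))
    ℓ<2M+1 : ℓ < 2 * M + 1
    ℓ<2M+1 = ℕ.<-≤-trans ℓ<g[2s+1]
      (ℕ.≤-trans (ℕ.*-monoˡ-≤ (2 * s + 1) g≤m) (ℕ.≤-reflexive (trans (ℕ.*-comm m (2 * s + 1)) N≡2M+1)))
      where
      g≤m : g ≤ m
      g≤m = proj₂ (proj₂ g-oddGirth) m (n , refl) hasCycle
    r<M : r < M
    r<M = ℕ.*-cancelˡ-< 2 r M (ℕ.+-cancelʳ-< 1 (2 * r) (2 * M) ℓ<2M+1)

  witness : ThetaAdmissible (Cycle m) n 1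
  witness = (3 , chromatic-number , fracPower-colorable) , (m , oddGirth , ℕ.m<m*n m 3 (s≤s (s≤s z≤n)))
    where
    instance
      m-nonZero : NonZero m
      m-nonZero = ℕ.>-nonZero (ℕ.m≤n+m 1 (2 * n))
    3m≡2M+1 : 3 * m ≡ 2 * (3 * n + 1) + 1
    3m≡2M+1 = lemma n
      where
      lemma : ∀ n → 3 * (2 * n + 1) ≡ 2 * (3 * n + 1) + 1
      lemma = ℕ-Solver.solve-∀
    fracPower-colorable : Colorable (FracPower (Cycle m) n 1) 3
    fracPower-colorable = Equivalence.from (fracPower-cycle-colorable⇔ n 1 3 1<m)
      (subst (λ K → Colorable (Power (Cyc K) (2 * n + 1)) 3) (sym 3m≡2M+1)
        (Equivalence.from (oddCyclePower-3-colorable⇔ (3 * n + 1) n n<3n+1) (ℕ.≤-reflexive 3m≡2M+1)))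
      where
      n<3n+1 : n < 3 * n + 1
      n<3n+1 = ℕ.≤-trans (ℕ.m≤n+m (suc n) (2 * n)) (ℕ.≤-reflexive (lemma n))
        where
        lemma : ∀ n → 2 * n + suc n ≡ 3 * n + 1
        lemma = ℕ-Solver.solve-∀

  theta : IsTheta (Cycle m) m 3
  theta = admissible⇒bound , λ c d _ bound → bound n 1 witness

lemma3p7 : (n t : ℕ) → t < n →
    (Power (toGraph (Cycle (2 * n + 1))) (2 * t + 1) ≅ CircK (2 * n + 1) (n ∸ t))
    × IsTheta (Cycle (2 * n + 1)) (2 * n + 1) 3
lemma3p7 n t t<n = oddCyclePower≅circularClique n t t<n , ThetaOfOddCycle.theta n (ℕ.≤-<-trans z≤n t<n)
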